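{- Let $N$ be a positive integer, $k$ a positive integer, and $\boldsymbol{k}$, $\boldsymbol{l}$ (nonempty) indices, and let $\boldsymbol{x}$ be a tuple of indeterminates of the appropriate length (namely $\mathrm{dep}(\boldsymbol{k})+1+\mathrm{dep}(\boldsymbol{l})$, $\mathrm{dep}(\boldsymbol{k})+1$, $1+\mathrm{dep}(\boldsymbol{l})$ respectively). Then \[ Z_N^{(\boldsymbol{x})}(\boldsymbol{k}, k \mid \boldsymbol{l}) = Z_N^{(\boldsymbol{x})}(\boldsymbol{k} \mid k, \boldsymbol{l}),\qquad Z_N^{(\boldsymbol{x})}(\boldsymbol{k}, k \mid ) = Z_N^{(\boldsymbol{x})}(\boldsymbol{k} \mid k),\qquad Z_N^{(\boldsymbol{x})}(k \mid \boldsymbol{l}) = Z_N^{(\boldsymbol{x})}( \mid k, \boldsymbol{l}). \]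
   Context: An index is a tuple of positive integers; $\mathrm{dep}$ is its length; $(\boldsymbol{k},k)$ denotes concatenation. $\binom{y}{n}\coloneqq\frac{y(y-1)\cdots(y-n+1)}{n!}$ ($n\ge1$), $\binom{y}{0}=1$. Fix $N$. Connector: $C_N^{(x)}(n,m)\coloneqq\binom{m}{n}/\binom{Nx-1}{n}$. For indices $\boldsymbol{k}=(k_1,\dots,k_r)$, $\boldsymbol{l}=(l_1,\dots,l_s)$ (both nonempty), let $S_N(\boldsymbol{k};\boldsymbol{l})$ be the set of integer tuples $(\boldsymbol{n},\boldsymbol{m}_1,\dots,\boldsymbol{m}_s)$, $\boldsymbol{n}=(n_1,\dots,n_r)$, $\boldsymbol{m}_i=(m_{i,1},\dots,m_{i,l_i})$, with $0<n_1<\cdots<n_r<m_{1,1}$, all $m_{i,j}\le N$, $m_{i,j}\le m_{i,j+1}$ ($1\le j<l_i$), $m_{i,l_i}<m_{i+1,1}$ ($1\le i<s$). For indeterminates $\boldsymbol{x}=(x_1,\dots,x_{r+s})$ set \[Z_N^{(\boldsymbol{x})}(\boldsymbol{k} \mid \boldsymbol{l}) \coloneqq \sum_{S_N(\boldsymbol{k};\boldsymbol{l})} Q_{\boldsymbol{k}}^{(x_1,\dots, x_r)}(\boldsymbol{n})\, C_N^{(x_r)}(n_r, m_{1,1}-1) \prod_{j=1}^s P_{N,l_j}^{(x_{r+j})}(\boldsymbol{m}_j),\] where $Q_{\boldsymbol{k}}^{(x_1,\dots,x_r)}(\boldsymbol{n}) \coloneqq \frac{1}{n_1^{k_1} \cdots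 n_r^{k_r}} \prod_{i=1}^{r-1}\frac{\binom{Nx_{i+1}-1}{n_i}}{\binom{Nx_i-1}{n_i}}$ and $P_{N,l}^{(x)}(\boldsymbol{m}) \coloneqq \frac{1}{(Nx - m_1) m_2 \cdots m_l}$. Moreover, for $\boldsymbol{k}=(k_1,\dots,k_r)$ and $\boldsymbol{x}=(x_1,\dots,x_r)$, \[Z_N^{(\boldsymbol{x})}(\boldsymbol{k}\mid)\coloneqq\sum_{0<n_1<\cdots<n_r\leq N}\frac{1}{n_1^{k_1}\cdots n_r^{k_r}}\left[\prod_{i=1}^{r-1}\frac{\binom{Nx_{i+1}-1}{n_i}}{\binom{Nx_i-1}{n_i}}\right]\frac{\binom{N}{n_r}}{\binom{Nx_r-1}{n_r}},\] \[Z_N^{(\boldsymbol{x})}(\mid\boldsymbol{k})\coloneqq(-1)^r\sum_{\substack{1\leq n_{j,1}\leq\cdots\leq n_{j,k_j}\leq N \ (1\leq j\leq r)\\ n_{j,k_j}<n_{j+1,1} \ (1\leq j<r)}}\prod_{j=1}^r\frac{1}{(n_{j,1}-Nx_j)n_{j,2}\cdots n_{j,k_j}}.\] -}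

module Defs where

open import Data.Nat as ℕ using (ℕ; zero; suc; _∸_)
open import Data.Integer as ℤ using (ℤ)
open import Data.Rational as ℚ using (ℚ; 0ℚ; 1ℚ; _+_; _*_; _-_; -_)
open import Data.Rational.Properties as ℚP using ()
open import Data.List as L using (List; []; _∷_; [_]; map; concatMap; upTo; foldr; zipWith; take; drop; length)
open import Relation.Nullary using (yes; no)
open import Relation.Binary.PropositionalEquality using (_≢_)

ι : ℕ → ℚ
ι n = ℤ.+ n ℚ./ 1

-- total reciprocal (used only at nonzero arguments under the hypotheses
-- of the theorem; value at 0 is irrelevant and set to 0)
inv : ℚ → ℚ
inv p with p ℚP.≟ 0ℚ
... | yes _  = 0ℚ
... | no p≢0 = ℚ.1/_ p {{ℚ.≢-nonZero p≢0}}

sumℚ : List ℚ → ℚ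
sumℚ = foldr _+_ 0ℚ

prodℚ : List ℚ → ℚ
prodℚ = foldr _*_ 1ℚ

powℚ : ℚ → ℕ → ℚ
powℚ q zero    = 1ℚ
powℚ q (suc n) = q * powℚ q n

factℚ : ℕ → ℚ
factℚ zero    = 1ℚ
factℚ (suc n) = ι (suc n) * factℚ n

falling : ℚ → ℕ → ℚ
falling y zero    = 1ℚ
falling y (suc n) = falling y n * (y - ι n)

binom : ℚ → ℕ → ℚ
binom y n = falling y n * inv (factℚ n)

range : ℕ → ℕ → List ℕ
range a b = map (a ℕ.+_) (upTo (suc b ∸ a))

-- strictly increasing tuples lo < n₁ < ... < n_r ≤ N of length r
incChains : ℕ → ℕ → ℕ → List (List ℕ)
incChains lo zero    N = [ [] ]
incChains lo (suc r) N = concatMap (λ a → map (a ∷_) (incChains a r N)) (range (suc lo) N)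

-- weakly increasing tuples lo ≤ m₁ ≤ ... ≤ m_l ≤ N of length l
weakChains : ℕ → ℕ → ℕ → List (List ℕ)
weakChains lo zero    N = [ [] ]
weakChains lo (suc l) N = concatMap (λ a → map (a ∷_) (weakChains a l N)) (range lo N)

lastℕ : ℕ → List ℕ → ℕ
lastℕ d []       = d
lastℕ d (x ∷ xs) = lastℕ x xs

lastℚ : List ℚ → ℚ
lastℚ []       = 0ℚ
lastℚ (x ∷ xs) = lastQ' x xs
  where
  lastQ' : ℚ → List ℚ → ℚ
  lastQ' y []       = y
  lastQ' y (z ∷ zs) = lastQ' z zs

headℕ : List ℕ → ℕ
headℕ []      = 0
headℕ (x ∷ _) = x

-- families of blocks (m₁, ..., m_s), m_i = (m_{i,1},...,m_{i,l_i}) with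
-- lo < m_{1,1}, m_{i,j} ≤ m_{i,j+1}, m_{i,l_i} < m_{i+1,1}, all ≤ N
blocks : ℕ → List ℕ → ℕ → List (List (List ℕ))
blocks lo []       N = [ [] ]
blocks lo (l ∷ ls) N =
  concatMap (λ b → map (b ∷_) (blocks (lastℕ lo b) ls N)) (weakChains (suc lo) l N)

headBlock : List (List ℕ) → ℕ
headBlock []      = 0
headBlock (b ∷ _) = headℕ b

ratios : ℕ → List ℕ → List ℚ → ℚ
ratios N (n ∷ n' ∷ ns) (x ∷ x' ∷ xs) =
  binom (ι N * x' - 1ℚ) n * inv (binom (ι N * x - 1ℚ) n) * ratios N (n' ∷ ns) (x' ∷ xs)
ratios N _ _ = 1ℚ

Qk : ℕ → List ℕ → List ℚ → List ℕ → ℚ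
Qk N ks xs ns = inv (prodℚ (zipWith (λ n k → powℚ (ι n) k) ns ks)) * ratios N ns xs

Conn : ℕ → ℚ → ℕ → ℕ → ℚ
Conn N x n m = binom (ι m) n * inv (binom (ι N * x - 1ℚ) n)

PN : ℕ → ℚ → List ℕ → ℚ
PN N x []       = 1ℚ   -- not used (l ≥ 1)
PN N x (m ∷ ms) = inv ((ι N * x - ι m) * prodℚ (map ι ms))

Zkl : ℕ → List ℚ → List ℕ → List ℕ → ℚ
Zkl N xs ks ls =
  sumℚ (concatMap (λ ns →
    map (λ ms →
      Qk N ks xr ns
      * Conn N (lastℚ xr) (lastℕ 0 ns) (headBlock ms ∸ 1)
      * prodℚ (zipWith (PN N) xl ms))
    (blocks (lastℕ 0 ns) ls N))
  (incChains 0 (length ks) N))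
  where
  xr = take (length ks) xs
  xl = drop (length ks) xs

Zk- : ℕ → List ℚ → List ℕ → ℚ
Zk- N xs ks =
  sumℚ (map (λ ns →
      inv (prodℚ (zipWith (λ n k → powℚ (ι n) k) ns ks))
      * ratios N ns xs
      * binom (ι N) (lastℕ 0 ns) * inv (binom (ι N * lastℚ xs - 1ℚ) (lastℕ 0 ns)))
    (incChains 0 (length ks) N))

Pneg : ℕ → ℚ → List ℕ → ℚ
Pneg N x []       = 1ℚ   -- not used (k ≥ 1)
Pneg N x (n ∷ ns) = inv ((ι n - ι N * x) * prodℚ (map ι ns))

Z-k : ℕ → List ℚ → List ℕ → ℚ
Z-k N xs ks =
  powℚ (- 1ℚ) (length ks)
  * sumℚ (map (λ ms → prodℚ (zipWith (Pneg N) xs ms)) (blocks 0 ks N))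

data Index : List ℕ → Set where
  []  : Index []
  _∷_ : ∀ {k ks} → 1 ℕ.≤ k → Index ks → Index (k ∷ ks)

-- x is "generic": N x ∉ {1, ..., N}, so every denominator
-- binom(N x - 1, n) (0 ≤ n < N) and N x - m (1 ≤ m ≤ N) is nonzero.
data Admissible (N : ℕ) : List ℚ → Set where
  []  : Admissible N []
  _∷_ : ∀ {x xs} → (∀ j → 1 ℕ.≤ j → j ℕ.≤ N → ι N * x ≢ ι j) → Admissible N xs → Admissible N (x ∷ xs)

{-# OPTIONS --safe #-}
-- Each relation comes from summing out a single variable: the last left index n_r,
-- which carries 1/n^k and the connector to the right part.  With z = N x and
-- y = z - 1, the heart of the matter is the telescoping identity
--   Σ_{a<n≤m} binom(y,a) binom(m-1,n-1) / (n binom(y,n)) = binom(m-1,a) / (z-m),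
-- whose summands are differences of consecutive terms binom(m-1,n-1) / (binom(y,n-1) (z-m)).
-- The connector binom(M-1,n) / binom(y,n) is first expanded by the hockey-stick
-- identity into Σ_{n≤m<M} binom(m-1,n-1); the remaining k-1 factors 1/n are traded,
-- by absorption and the hockey-stick identity again, for variables m ≤ m₂ ≤ ... ≤ m_k
-- weighted 1/m₂⋯m_k.  Summing out n_r thus creates a new first right block with
-- exactly the weight P_{N,k} and the connector to n_{r-1}.  The boundary relations are
-- the same computation, with binom(N,n) = Σ_{n≤m≤N} binom(m-1,n-1) as the terminal
-- connector, and, when the left part empties, with 1/(n-Nx) = -1/(Nx-n) absorbing
-- the sign (-1)^dep.
module Submission where

open import Defs

-- Kept apart from the statement's imports at the end, whose ℕ addition would clash with ℚ's.
module ConnectedSums where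

  open import Data.Nat as ℕ using (ℕ; zero; suc; _∸_; _≤_; _<_; z≤n; s≤s; pred)
  import Data.Nat.Properties as ℕP
  import Data.Integer as ℤ
  import Data.Integer.Properties as ℤP
  open import Data.Rational as ℚ using (ℚ; 0ℚ; 1ℚ; _+_; _*_; _-_; -_; mkℚ)
  import Data.Rational.Properties as ℚP
  open import Data.Rational.Solver using (module +-*-Solver)
  open +-*-Solver
  import Data.Nat.Coprimality as Coprime
  open import Data.List using (List; []; _∷_; _++_; [_]; length; map; concatMap; applyUpTo; upTo; zipWith; take; drop)
  import Data.List.Properties as LP
  open import Data.Empty using (⊥-elim)
  open import Data.Sum using (_⊎_; inj₁; inj₂)
  open import Data.Product using (_×_; _,_; ∃-syntax)
  open import Function using (_∘_; id)
  open import Relation.Nullary using (yes; no; contradiction)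
  open import Relation.Binary.PropositionalEquality
    using (_≡_; _≢_; refl; sym; trans; cong; cong₂; subst; module ≡-Reasoning)
  open ≡-Reasoning

  ι≡mkℚ : ∀ n → ι n ≡ mkℚ (ℤ.+ n) 0 (Coprime.sym (Coprime.1-coprimeTo n))
  ι≡mkℚ n = ℚP.normalize-coprime (Coprime.sym (Coprime.1-coprimeTo n))

  ι-+ : ∀ m n → ι (m ℕ.+ n) ≡ ι m + ι n
  ι-+ m n rewrite ι≡mkℚ m | ι≡mkℚ n =
    cong (ℚ._/ 1) (sym (cong₂ ℤ._+_ (ℤP.*-identityʳ (ℤ.+ m)) (ℤP.*-identityʳ (ℤ.+ n))))

  ι-suc : ∀ n → ι (suc n) ≡ 1ℚ + ι n
  ι-suc = ι-+ 1

  ι-suc≢0 : ∀ n → ι (suc n) ≢ 0ℚ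
  ι-suc≢0 n eq with trans (sym (ι≡mkℚ (suc n))) eq
  ... | ()

  p-q≡0⇒p≡q : ∀ p q → p - q ≡ 0ℚ → p ≡ q
  p-q≡0⇒p≡q p q eq = begin
    p           ≡⟨ solve 2 (λ p q → p := (p :- q) :+ q) refl p q ⟩
    (p - q) + q ≡⟨ cong (_+ q) eq ⟩
    0ℚ + q      ≡⟨ ℚP.+-identityˡ q ⟩
    q           ∎

  *-invʳ : ∀ p → p ≢ 0ℚ → p * inv p ≡ 1ℚ
  *-invʳ p p≢0 with p ℚP.≟ 0ℚ
  ... | yes p≡0 = contradiction p≡0 p≢0
  ... | no p≢0′ = ℚP.*-inverseʳ p {{ℚ.≢-nonZero p≢0′}}

  inv-unique : ∀ p q → p * q ≡ 1ℚ → inv p ≡ q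
  inv-unique p q pq≡1 = begin
    inv p           ≡⟨ sym (ℚP.*-identityʳ (inv p)) ⟩
    inv p * 1ℚ      ≡⟨ cong (inv p *_) (sym pq≡1) ⟩
    inv p * (p * q) ≡⟨ solve 3 (λ p q i → i :* (p :* q) := (p :* i) :* q) refl p q (inv p) ⟩
    p * inv p * q   ≡⟨ cong (_* q) (*-invʳ p p≢0) ⟩
    1ℚ * q          ≡⟨ ℚP.*-identityˡ q ⟩
    q               ∎
    where
    p≢0 : p ≢ 0ℚ
    p≢0 refl = ℚP.1≢0 (trans (sym pq≡1) (ℚP.*-zeroˡ q))

  -- Case splits go through this rather than p ℚP.≟ 0ℚ, whose with-abstraction would
  -- also rewrite the copy of that test inside inv p.
  ≡0⊎≢0 : ∀ p → p ≡ 0ℚ ⊎ p ≢ 0ℚ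
  ≡0⊎≢0 p with p ℚP.≟ 0ℚ
  ... | yes p≡0 = inj₁ p≡0
  ... | no p≢0  = inj₂ p≢0

  inv-distrib-* : ∀ p q → inv (p * q) ≡ inv p * inv q
  inv-distrib-* p q with ≡0⊎≢0 p | ≡0⊎≢0 q
  ... | inj₁ refl | _        = trans (cong inv (ℚP.*-zeroˡ q)) (sym (ℚP.*-zeroˡ (inv q)))
  ... | inj₂ _    | inj₁ refl = trans (cong inv (ℚP.*-zeroʳ p)) (sym (ℚP.*-zeroʳ (inv p)))
  ... | inj₂ p≢0  | inj₂ q≢0  = inv-unique (p * q) (inv p * inv q) (begin
    p * q * (inv p * inv q)   ≡⟨ solve 4 (λ p q i j → p :* q :* (i :* j) := (p :* i) :* (q :* j)) refl p q (inv p) (inv q) ⟩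
    p * inv p * (q * inv q)   ≡⟨ cong₂ _*_ (*-invʳ p p≢0) (*-invʳ q q≢0) ⟩
    1ℚ                        ∎)

  inv-neg : ∀ p → inv (- p) ≡ - inv p
  inv-neg p with ≡0⊎≢0 p
  ... | inj₁ refl = refl
  ... | inj₂ p≢0  = inv-unique (- p) (- inv p)
    (trans (solve 2 (λ p i → (:- p) :* (:- i) := p :* i) refl p (inv p)) (*-invʳ p p≢0))

  inv-involutive : ∀ p → inv (inv p) ≡ p
  inv-involutive p with ≡0⊎≢0 p
  ... | inj₁ refl = refl
  ... | inj₂ p≢0  = inv-unique (inv p) p (trans (ℚP.*-comm (inv p) p) (*-invʳ p p≢0))

  *-≢0 : ∀ p q → p ≢ 0ℚ → q ≢ 0ℚ → p * q ≢ 0ℚ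
  *-≢0 p q p≢0 q≢0 pq≡0 = q≢0 (begin
    q               ≡⟨ sym (ℚP.*-identityˡ q) ⟩
    1ℚ * q          ≡⟨ cong (_* q) (sym (*-invʳ p p≢0)) ⟩
    p * inv p * q   ≡⟨ solve 3 (λ p q i → (p :* i) :* q := i :* (p :* q)) refl p q (inv p) ⟩
    inv p * (p * q) ≡⟨ cong (inv p *_) pq≡0 ⟩
    inv p * 0ℚ      ≡⟨ ℚP.*-zeroʳ (inv p) ⟩
    0ℚ              ∎)

  inv-≢0 : ∀ p → p ≢ 0ℚ → inv p ≢ 0ℚ
  inv-≢0 p p≢0 inv≡0 = ℚP.1≢0 (trans (sym (*-invʳ p p≢0)) (trans (cong (p *_) inv≡0) (ℚP.*-zeroʳ p)))

  private variable
    A A′ : Set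

  ∑ : List A → (A → ℚ) → ℚ
  ∑ xs f = sumℚ (map f xs)

  infix 5 ∑
  syntax ∑ xs (λ x → e) = ∑[ x ∈ xs ] e

  sumℚ-++ : ∀ xs ys → sumℚ (xs ++ ys) ≡ sumℚ xs + sumℚ ys
  sumℚ-++ []       ys = sym (ℚP.+-identityˡ _)
  sumℚ-++ (x ∷ xs) ys = trans (cong (x +_) (sumℚ-++ xs ys)) (sym (ℚP.+-assoc x _ _))

  sumℚ-concatMap : ∀ (g : A → List ℚ) xs → sumℚ (concatMap g xs) ≡ ∑[ a ∈ xs ] sumℚ (g a)
  sumℚ-concatMap g []       = refl
  sumℚ-concatMap g (x ∷ xs) = trans (sumℚ-++ (g x) _) (cong (sumℚ (g x) +_) (sumℚ-concatMap g xs))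

  ∑-cong : ∀ (xs : List A) {f g} → (∀ x → f x ≡ g x) → ∑ xs f ≡ ∑ xs g
  ∑-cong xs f≗g = cong sumℚ (LP.map-cong f≗g xs)

  *-distribˡ-∑ : ∀ c (xs : List A) f → c * ∑ xs f ≡ ∑[ x ∈ xs ] c * f x
  *-distribˡ-∑ c []       f = ℚP.*-zeroʳ c
  *-distribˡ-∑ c (x ∷ xs) f = trans (ℚP.*-distribˡ-+ c (f x) _) (cong (c * f x +_) (*-distribˡ-∑ c xs f))

  *-distribʳ-∑ : ∀ c (xs : List A) f → ∑ xs f * c ≡ ∑[ x ∈ xs ] f x * c
  *-distribʳ-∑ c xs f = trans (ℚP.*-comm _ c)
    (trans (*-distribˡ-∑ c xs f) (∑-cong xs (λ x → ℚP.*-comm c (f x))))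

  ∑-+ : ∀ (xs : List A) f g → ∑[ x ∈ xs ] (f x + g x) ≡ ∑ xs f + ∑ xs g
  ∑-+ []       f g = refl
  ∑-+ (x ∷ xs) f g = trans (cong (f x + g x +_) (∑-+ xs f g))
    (solve 4 (λ a b c d → a :+ b :+ (c :+ d) := a :+ c :+ (b :+ d)) refl (f x) (g x) _ _)

  ∑-map : ∀ (g : A → A′) (xs : List A) f → ∑ (map g xs) f ≡ ∑ xs (f ∘ g)
  ∑-map g xs f = cong sumℚ (sym (LP.map-∘ xs))

  ∑-concatMap : ∀ (g : A → List A′) xs f → ∑ (concatMap g xs) f ≡ ∑[ a ∈ xs ] ∑ (g a) f
  ∑-concatMap g xs f = trans (cong sumℚ (LP.map-concatMap f g xs)) (sumℚ-concatMap (map f ∘ g) xs)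

  ∑-concatMap-∷ : ∀ (g : A → List (List A)) xs f →
    ∑ (concatMap (λ a → map (a ∷_) (g a)) xs) f ≡ ∑[ a ∈ xs ] ∑[ t ∈ g a ] f (a ∷ t)
  ∑-concatMap-∷ g xs f = trans (∑-concatMap (λ a → map (a ∷_) (g a)) xs f)
    (∑-cong xs (λ a → ∑-map (a ∷_) (g a) f))

  ∑-concatMap-∷-cong : ∀ (g : A → List (List A)) xs {f f′} → (∀ a t → f (a ∷ t) ≡ f′ (a ∷ t)) →
    ∑ (concatMap (λ a → map (a ∷_) (g a)) xs) f ≡ ∑ (concatMap (λ a → map (a ∷_) (g a)) xs) f′
  ∑-concatMap-∷-cong g xs f≗f′ = trans (∑-concatMap-∷ g xs _)
    (trans (∑-cong xs (λ a → ∑-cong (g a) (f≗f′ a))) (sym (∑-concatMap-∷ g xs _)))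

  sumUpTo : ℕ → (ℕ → ℚ) → ℚ
  sumUpTo zero    h = 0ℚ
  sumUpTo (suc n) h = h 0 + sumUpTo n (h ∘ suc)

  ∑-applyUpTo : ∀ (g : ℕ → A) n f → ∑ (applyUpTo g n) f ≡ sumUpTo n (f ∘ g)
  ∑-applyUpTo g zero    f = refl
  ∑-applyUpTo g (suc n) f = cong (f (g 0) +_) (∑-applyUpTo (g ∘ suc) n f)

  sumUpTo-cong : ∀ n {h h′} → (∀ i → i < n → h i ≡ h′ i) → sumUpTo n h ≡ sumUpTo n h′
  sumUpTo-cong zero    h≗h′ = refl
  sumUpTo-cong (suc n) h≗h′ = cong₂ _+_ (h≗h′ 0 (s≤s z≤n)) (sumUpTo-cong n (λ i i<n → h≗h′ (suc i) (s≤s i<n)))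

  sumUpTo-snoc : ∀ n h → sumUpTo (suc n) h ≡ sumUpTo n h + h n
  sumUpTo-snoc zero    h = trans (ℚP.+-identityʳ (h 0)) (sym (ℚP.+-identityˡ (h 0)))
  sumUpTo-snoc (suc n) h = trans (cong (h 0 +_) (sumUpTo-snoc n (h ∘ suc))) (sym (ℚP.+-assoc (h 0) _ _))

  ∑ᵣ : ℕ → ℕ → (ℕ → ℚ) → ℚ
  ∑ᵣ a b f = ∑ (range a b) f

  infix 5 ∑ᵣ
  syntax ∑ᵣ a b (λ i → e) = ∑[ i ∈ a ⋯ b ] e

  ∑ᵣ≡sumUpTo : ∀ a b f → ∑ᵣ a b f ≡ sumUpTo (suc b ∸ a) (f ∘ (a ℕ.+_))
  ∑ᵣ≡sumUpTo a b f = trans (∑-map (a ℕ.+_) (upTo (suc b ∸ a)) f) (∑-applyUpTo id (suc b ∸ a) (f ∘ (a ℕ.+_)))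

  ∑ᵣ-empty : ∀ {a b} f → b < a → ∑ᵣ a b f ≡ 0ℚ
  ∑ᵣ-empty {a} {b} f b<a = trans (∑ᵣ≡sumUpTo a b f) (cong (λ n → sumUpTo n (f ∘ (a ℕ.+_))) (ℕP.m≤n⇒m∸n≡0 b<a))

  ∑ᵣ-cons : ∀ {a b} f → a ≤ b → ∑ᵣ a b f ≡ f a + ∑ᵣ (suc a) b f
  ∑ᵣ-cons {a} {b} f a≤b = begin
    ∑ᵣ a b f                                         ≡⟨ ∑ᵣ≡sumUpTo a b f ⟩
    sumUpTo (suc b ∸ a) (f ∘ (a ℕ.+_))               ≡⟨ cong (λ n → sumUpTo n (f ∘ (a ℕ.+_))) (ℕP.+-∸-assoc 1 a≤b) ⟩
    f (a ℕ.+ 0) + sumUpTo (b ∸ a) (f ∘ (a ℕ.+_) ∘ suc)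
      ≡⟨ cong₂ _+_ (cong f (ℕP.+-identityʳ a)) (sumUpTo-cong (b ∸ a) (λ i _ → cong f (ℕP.+-suc a i))) ⟩
    f a + sumUpTo (b ∸ a) (f ∘ (suc a ℕ.+_))         ≡⟨ cong (f a +_) (sym (∑ᵣ≡sumUpTo (suc a) b f)) ⟩
    f a + ∑ᵣ (suc a) b f                             ∎

  ∑ᵣ-snoc : ∀ {a b} f → a ≤ suc b → ∑ᵣ a (suc b) f ≡ ∑ᵣ a b f + f (suc b)
  ∑ᵣ-snoc {a} {b} f a≤1+b = begin
    ∑ᵣ a (suc b) f                                   ≡⟨ ∑ᵣ≡sumUpTo a (suc b) f ⟩
    sumUpTo (suc (suc b) ∸ a) (f ∘ (a ℕ.+_))         ≡⟨ cong (λ n → sumUpTo n (f ∘ (a ℕ.+_))) (ℕP.+-∸-assoc 1 a≤1+b) ⟩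
    sumUpTo (suc (suc b ∸ a)) (f ∘ (a ℕ.+_))         ≡⟨ sumUpTo-snoc (suc b ∸ a) _ ⟩
    sumUpTo (suc b ∸ a) (f ∘ (a ℕ.+_)) + f (a ℕ.+ (suc b ∸ a))
      ≡⟨ cong₂ _+_ (sym (∑ᵣ≡sumUpTo a b f)) (cong f (ℕP.m+[n∸m]≡n a≤1+b)) ⟩
    ∑ᵣ a b f + f (suc b)                             ∎

  ∑ᵣ-cong : ∀ a b {f g} → (∀ i → a ≤ i → i ≤ b → f i ≡ g i) → ∑ᵣ a b f ≡ ∑ᵣ a b g
  ∑ᵣ-cong a b {f} {g} f≗g =
    trans (∑ᵣ≡sumUpTo a b f) (trans (sumUpTo-cong (suc b ∸ a) shifted) (sym (∑ᵣ≡sumUpTo a b g)))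
    where
    shifted : ∀ i → i < suc b ∸ a → f (a ℕ.+ i) ≡ g (a ℕ.+ i)
    shifted i i<1+b∸a = f≗g (a ℕ.+ i) (ℕP.m≤m+n a i)
      (subst (_≤ b) (ℕP.+-comm i a) (ℕP.≤-pred (ℕP.m≤o∸n⇒m+n≤o (suc i) a≤1+b i<1+b∸a)))
      where
      a≤1+b : a ≤ suc b
      a≤1+b = ℕP.<⇒≤ (ℕP.m∸n≢0⇒n<m (λ eq → ℕP.n≮0 (subst (i <_) eq i<1+b∸a)))

  ∑ᵣ-cons-0 : ∀ a b f → f a ≡ 0ℚ → ∑ᵣ a b f ≡ ∑ᵣ (suc a) b f
  ∑ᵣ-cons-0 a b f fa≡0 with a ℕP.≤? b
  ... | yes a≤b = trans (∑ᵣ-cons f a≤b) (trans (cong (_+ ∑ᵣ (suc a) b f) fa≡0) (ℚP.+-identityˡ _))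
  ... | no a≰b  = trans (∑ᵣ-empty f (ℕP.≰⇒> a≰b)) (sym (∑ᵣ-empty f (ℕP.m<n⇒m<1+n (ℕP.≰⇒> a≰b))))

  module _ (b : ℕ) (P : ℕ → Set) (beyond : ∀ {a} → b < a → P a) (step : ∀ {a} → a ≤ b → P (suc a) → P a) where

    downward-induction : ∀ a → P a
    downward-induction a = go (suc b ∸ a) a ℕP.≤-refl
      where
      go : ∀ n a → suc b ∸ a ≤ n → P a
      go zero    a h = beyond (ℕP.m∸n≡0⇒m≤n (ℕP.n≤0⇒n≡0 h))
      go (suc n) a h with a ℕP.≤? b
      ... | no a≰b  = beyond (ℕP.≰⇒> a≰b)
      ... | yes a≤b = step a≤b (go n (suc a) (ℕP.≤-pred (subst (_≤ suc n) (ℕP.+-∸-assoc 1 a≤b) h)))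

  ∑ᵣ-interchange : ∀ a b (F : ℕ → ℕ → ℚ) →
    ∑[ i ∈ a ⋯ b ] ∑[ j ∈ i ⋯ b ] F i j ≡ ∑[ j ∈ a ⋯ b ] ∑[ i ∈ a ⋯ j ] F i j
  ∑ᵣ-interchange a b F = downward-induction b Interchanged beyond step a
    where
    Interchanged : ℕ → Set
    Interchanged a = ∑[ i ∈ a ⋯ b ] ∑[ j ∈ i ⋯ b ] F i j ≡ ∑[ j ∈ a ⋯ b ] ∑[ i ∈ a ⋯ j ] F i j
    beyond : ∀ {a} → b < a → Interchanged a
    beyond b<a = trans (∑ᵣ-empty _ b<a) (sym (∑ᵣ-empty _ b<a))
    step : ∀ {a} → a ≤ b → Interchanged (suc a) → Interchanged a
    step {a} a≤b ih = begin
      ∑[ i ∈ a ⋯ b ] ∑[ j ∈ i ⋯ b ] F i j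
        ≡⟨ ∑ᵣ-cons _ a≤b ⟩
      (∑[ j ∈ a ⋯ b ] F a j) + (∑[ i ∈ suc a ⋯ b ] ∑[ j ∈ i ⋯ b ] F i j)
        ≡⟨ cong (∑ᵣ a b (F a) +_) ih ⟩
      (∑[ j ∈ a ⋯ b ] F a j) + (∑[ j ∈ suc a ⋯ b ] ∑[ i ∈ suc a ⋯ j ] F i j)
        ≡⟨ cong (∑ᵣ a b (F a) +_)
             (sym (∑ᵣ-cons-0 a b (λ j → ∑[ i ∈ suc a ⋯ j ] F i j) (∑ᵣ-empty _ (ℕP.n<1+n a)))) ⟩
      (∑[ j ∈ a ⋯ b ] F a j) + (∑[ j ∈ a ⋯ b ] ∑[ i ∈ suc a ⋯ j ] F i j)
        ≡⟨ sym (∑-+ (range a b) _ _) ⟩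
      ∑[ j ∈ a ⋯ b ] (F a j + (∑[ i ∈ suc a ⋯ j ] F i j))
        ≡⟨ ∑ᵣ-cong a b (λ j a≤j _ → sym (∑ᵣ-cons (λ i → F i j) a≤j)) ⟩
      ∑[ j ∈ a ⋯ b ] ∑[ i ∈ a ⋯ j ] F i j
        ∎

  ∑ᵣ-interchange-strict : ∀ a b (F : ℕ → ℕ → ℚ) →
    ∑[ i ∈ a ⋯ b ] ∑[ j ∈ suc i ⋯ b ] F i j ≡ ∑[ j ∈ suc a ⋯ b ] ∑[ i ∈ a ⋯ pred j ] F i j
  ∑ᵣ-interchange-strict a b F = downward-induction b Interchanged beyond step a
    where
    Interchanged : ℕ → Set
    Interchanged a = ∑[ i ∈ a ⋯ b ] ∑[ j ∈ suc i ⋯ b ] F i j ≡ ∑[ j ∈ suc a ⋯ b ] ∑[ i ∈ a ⋯ pred j ] F i j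
    beyond : ∀ {a} → b < a → Interchanged a
    beyond b<a = trans (∑ᵣ-empty _ b<a) (sym (∑ᵣ-empty _ (ℕP.m<n⇒m<1+n b<a)))
    step : ∀ {a} → a ≤ b → Interchanged (suc a) → Interchanged a
    step {a} a≤b ih = begin
      ∑[ i ∈ a ⋯ b ] ∑[ j ∈ suc i ⋯ b ] F i j
        ≡⟨ ∑ᵣ-cons _ a≤b ⟩
      (∑[ j ∈ suc a ⋯ b ] F a j) + (∑[ i ∈ suc a ⋯ b ] ∑[ j ∈ suc i ⋯ b ] F i j)
        ≡⟨ cong (∑ᵣ (suc a) b (F a) +_) ih ⟩
      (∑[ j ∈ suc a ⋯ b ] F a j) + (∑[ j ∈ suc (suc a) ⋯ b ] ∑[ i ∈ suc a ⋯ pred j ] F i j)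
        ≡⟨ cong (∑ᵣ (suc a) b (F a) +_)
             (sym (∑ᵣ-cons-0 (suc a) b (λ j → ∑[ i ∈ suc a ⋯ pred j ] F i j) (∑ᵣ-empty _ (ℕP.n<1+n a)))) ⟩
      (∑[ j ∈ suc a ⋯ b ] F a j) + (∑[ j ∈ suc a ⋯ b ] ∑[ i ∈ suc a ⋯ pred j ] F i j)
        ≡⟨ sym (∑-+ (range (suc a) b) _ _) ⟩
      ∑[ j ∈ suc a ⋯ b ] (F a j + (∑[ i ∈ suc a ⋯ pred j ] F i j))
        ≡⟨ ∑ᵣ-cong (suc a) b (λ { (suc j) (s≤s a≤j) _ → sym (∑ᵣ-cons (λ i → F i (suc j)) a≤j) }) ⟩
      ∑[ j ∈ suc a ⋯ b ] ∑[ i ∈ a ⋯ pred j ] F i j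
        ∎

  ∑ᵣ-telescope : ∀ {p q} (t : ℕ → ℚ) → p ≤ suc q → ∑[ n ∈ p ⋯ q ] (t n - t (suc n)) ≡ t p - t (suc q)
  ∑ᵣ-telescope {p} {q} t = downward-induction q Telescopes beyond step p
    where
    Telescopes : ℕ → Set
    Telescopes p = p ≤ suc q → ∑[ n ∈ p ⋯ q ] (t n - t (suc n)) ≡ t p - t (suc q)
    beyond : ∀ {p} → q < p → Telescopes p
    beyond q<p p≤1+q rewrite ℕP.≤-antisym p≤1+q q<p =
      trans (∑ᵣ-empty _ (ℕP.n<1+n q)) (sym (ℚP.+-inverseʳ (t (suc q))))
    step : ∀ {p} → p ≤ q → Telescopes (suc p) → Telescopes p
    step {p} p≤q ih _ = begin
      ∑[ n ∈ p ⋯ q ] (t n - t (suc n))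
        ≡⟨ ∑ᵣ-cons _ p≤q ⟩
      (t p - t (suc p)) + (∑[ n ∈ suc p ⋯ q ] (t n - t (suc n)))
        ≡⟨ cong ((t p - t (suc p)) +_) (ih (s≤s p≤q)) ⟩
      (t p - t (suc p)) + (t (suc p) - t (suc q))
        ≡⟨ solve 3 (λ a b c → (a :- b) :+ (b :- c) := a :- c) refl (t p) (t (suc p)) (t (suc q)) ⟩
      t p - t (suc q)
        ∎

  binom-suc : ∀ y j → binom y (suc j) ≡ binom y j * (y - ι j) * inv (ι (suc j))
  binom-suc y j = begin
    falling y j * (y - ι j) * inv (ι (suc j) * factℚ j)
      ≡⟨ cong (falling y j * (y - ι j) *_) (inv-distrib-* (ι (suc j)) (factℚ j)) ⟩
    falling y j * (y - ι j) * (inv (ι (suc j)) * inv (factℚ j))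
      ≡⟨ solve 4 (λ f d a b → f :* d :* (a :* b) := f :* b :* d :* a) refl
           (falling y j) (y - ι j) (inv (ι (suc j))) (inv (factℚ j)) ⟩
    falling y j * inv (factℚ j) * (y - ι j) * inv (ι (suc j))
      ∎

  inv-binom-suc : ∀ y j → inv (binom y (suc j)) ≡ inv (binom y j) * inv (y - ι j) * ι (suc j)
  inv-binom-suc y j = begin
    inv (binom y (suc j))                              ≡⟨ cong inv (binom-suc y j) ⟩
    inv (binom y j * (y - ι j) * inv (ι (suc j)))      ≡⟨ inv-distrib-* (binom y j * (y - ι j)) _ ⟩
    inv (binom y j * (y - ι j)) * inv (inv (ι (suc j)))
      ≡⟨ cong₂ _*_ (inv-distrib-* (binom y j) (y - ι j)) (inv-involutive (ι (suc j))) ⟩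
    inv (binom y j) * inv (y - ι j) * ι (suc j)        ∎

  falling-1+ : ∀ y n → falling (1ℚ + y) (suc n) ≡ (1ℚ + y) * falling y n
  falling-1+ y zero    = solve 1 (λ y → con 1ℚ :* (con 1ℚ :+ y :- con 0ℚ) := (con 1ℚ :+ y) :* con 1ℚ) refl y
  falling-1+ y (suc n) = begin
    falling (1ℚ + y) (suc n) * (1ℚ + y - ι (suc n))
      ≡⟨ cong₂ (λ a b → a * (1ℚ + y - b)) (falling-1+ y n) (ι-suc n) ⟩
    (1ℚ + y) * falling y n * (1ℚ + y - (1ℚ + ι n))
      ≡⟨ solve 3 (λ y f i → (con 1ℚ :+ y) :* f :* (con 1ℚ :+ y :- (con 1ℚ :+ i)) := (con 1ℚ :+ y) :* (f :* (y :- i)))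
           refl y (falling y n) (ι n) ⟩
    (1ℚ + y) * (falling y n * (y - ι n))
      ∎

  binom-pascal : ∀ y n → binom (1ℚ + y) (suc n) ≡ binom y (suc n) + binom y n
  binom-pascal y n = begin
    falling (1ℚ + y) (suc n) * inv (J * factℚ n)
      ≡⟨ cong₂ _*_ (falling-1+ y n) (inv-distrib-* J (factℚ n)) ⟩
    (1ℚ + y) * f * (inv J * iF)
      ≡⟨ solve 5 (λ y f iJ iF i → (con 1ℚ :+ y) :* f :* (iJ :* iF) := f :* iF :* ((y :- i) :* iJ :+ (con 1ℚ :+ i) :* iJ))
           refl y f (inv J) iF (ι n) ⟩
    f * iF * ((y - ι n) * inv J + (1ℚ + ι n) * inv J)
      ≡⟨ cong (λ u → f * iF * ((y - ι n) * inv J + u * inv J)) (sym (ι-suc n)) ⟩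
    f * iF * ((y - ι n) * inv J + J * inv J)
      ≡⟨ cong (λ u → f * iF * ((y - ι n) * inv J + u)) (*-invʳ J (ι-suc≢0 n)) ⟩
    f * iF * ((y - ι n) * inv J + 1ℚ)
      ≡⟨ solve 5 (λ y f iJ iF i → f :* iF :* ((y :- i) :* iJ :+ con 1ℚ) := f :* (y :- i) :* (iJ :* iF) :+ f :* iF)
           refl y f (inv J) iF (ι n) ⟩
    f * (y - ι n) * (inv J * iF) + f * iF
      ≡⟨ cong (λ u → f * (y - ι n) * u + f * iF) (sym (inv-distrib-* J (factℚ n))) ⟩
    f * (y - ι n) * inv (J * factℚ n) + f * iF
      ∎
    where
    J = ι (suc n)
    f = falling y n
    iF = inv (factℚ n)

  binom[m,1+m]≡0 : ∀ m → binom (ι m) (suc m) ≡ 0ℚ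
  binom[m,1+m]≡0 m = begin
    falling (ι m) m * (ι m - ι m) * inv (factℚ (suc m))
      ≡⟨ cong (λ u → falling (ι m) m * u * inv (factℚ (suc m))) (ℚP.+-inverseʳ (ι m)) ⟩
    falling (ι m) m * 0ℚ * inv (factℚ (suc m))
      ≡⟨ cong (_* inv (factℚ (suc m))) (ℚP.*-zeroʳ (falling (ι m) m)) ⟩
    0ℚ * inv (factℚ (suc m))
      ≡⟨ ℚP.*-zeroˡ (inv (factℚ (suc m))) ⟩
    0ℚ
      ∎

  binom-absorb : ∀ m n → binom (ι (suc m)) (suc n) * inv (ι (suc m)) ≡ inv (ι (suc n)) * binom (ι m) n
  binom-absorb m n = begin
    falling (ι (suc m)) (suc n) * inv (J * factℚ n) * inv M
      ≡⟨ cong (λ u → falling u (suc n) * inv (J * factℚ n) * inv M) (ι-suc m) ⟩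
    falling (1ℚ + ι m) (suc n) * inv (J * factℚ n) * inv M
      ≡⟨ cong₂ (λ a b → a * b * inv M) (falling-1+ (ι m) n) (inv-distrib-* J (factℚ n)) ⟩
    (1ℚ + ι m) * f * (inv J * iF) * inv M
      ≡⟨ cong (λ u → u * f * (inv J * iF) * inv M) (sym (ι-suc m)) ⟩
    M * f * (inv J * iF) * inv M
      ≡⟨ solve 5 (λ M f iJ iF iM → M :* f :* (iJ :* iF) :* iM := (M :* iM) :* (iJ :* (f :* iF))) refl M f (inv J) iF (inv M) ⟩
    M * inv M * (inv J * (f * iF))
      ≡⟨ cong (_* (inv J * (f * iF))) (*-invʳ M (ι-suc≢0 m)) ⟩
    1ℚ * (inv J * (f * iF))
      ≡⟨ ℚP.*-identityˡ _ ⟩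
    inv J * (f * iF)
      ∎
    where
    J = ι (suc n)
    M = ι (suc m)
    f = falling (ι m) n
    iF = inv (factℚ n)

  hockey-stick : ∀ n c → n ≤ c → ∑[ m ∈ suc n ⋯ c ] binom (ι (m ∸ 1)) n ≡ binom (ι c) (suc n)
  hockey-stick n zero    z≤n = trans (∑ᵣ-empty (λ m → binom (ι (m ∸ 1)) 0) (ℕP.n<1+n 0)) (sym (binom[m,1+m]≡0 0))
  hockey-stick n (suc c) n≤1+c with n ℕP.≟ suc c
  ... | yes refl = trans (∑ᵣ-empty _ (ℕP.n<1+n (suc c))) (sym (binom[m,1+m]≡0 (suc c)))
  ... | no n≢1+c = begin
    ∑[ m ∈ suc n ⋯ suc c ] binom (ι (m ∸ 1)) n              ≡⟨ ∑ᵣ-snoc _ (s≤s n≤c) ⟩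
    (∑[ m ∈ suc n ⋯ c ] binom (ι (m ∸ 1)) n) + binom (ι c) n ≡⟨ cong (_+ binom (ι c) n) (hockey-stick n c n≤c) ⟩
    binom (ι c) (suc n) + binom (ι c) n                      ≡⟨ sym (binom-pascal (ι c) n) ⟩
    binom (1ℚ + ι c) (suc n)                                 ≡⟨ cong (λ w → binom w (suc n)) (sym (ι-suc c)) ⟩
    binom (ι (suc c)) (suc n)                                ∎
    where
    n≤c : n ≤ c
    n≤c = ℕP.≤-pred (ℕP.≤∧≢⇒< n≤1+c n≢1+c)

  factℚ≢0 : ∀ n → factℚ n ≢ 0ℚ
  factℚ≢0 zero    = ℚP.1≢0
  factℚ≢0 (suc n) = *-≢0 (ι (suc n)) (factℚ n) (ι-suc≢0 n) (factℚ≢0 n)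

  falling≢0 : ∀ y n → (∀ i → i < n → y - ι i ≢ 0ℚ) → falling y n ≢ 0ℚ
  falling≢0 y zero    _     = ℚP.1≢0
  falling≢0 y (suc n) y≢ι = *-≢0 _ _ (falling≢0 y n (λ i i<n → y≢ι i (ℕP.m<n⇒m<1+n i<n))) (y≢ι n (ℕP.n<1+n n))

  binom≢0 : ∀ y n → (∀ i → i < n → y - ι i ≢ 0ℚ) → binom y n ≢ 0ℚ
  binom≢0 y n y≢ι = *-≢0 _ _ (falling≢0 y n y≢ι) (inv-≢0 _ (factℚ≢0 n))

  module _ (N : ℕ) where

    starSum : ℕ → (ℕ → ℚ) → ℕ → ℚ
    starSum j Φ lo = ∑[ b ∈ weakChains lo j N ] inv (prodℚ (map ι b)) * Φ (lastℕ lo b)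

    starSum-zero : ∀ Φ lo → starSum 0 Φ lo ≡ Φ lo
    starSum-zero Φ lo = trans (ℚP.+-identityʳ (1ℚ * Φ lo)) (ℚP.*-identityˡ (Φ lo))

    starSum-suc : ∀ j Φ lo → starSum (suc j) Φ lo ≡ ∑[ m ∈ lo ⋯ N ] inv (ι m) * starSum j Φ m
    starSum-suc j Φ lo = trans (∑-concatMap-∷ (λ a → weakChains a j N) (range lo N) _)
      (∑-cong (range lo N) λ m → trans
        (∑-cong (weakChains m j N) λ b → trans
          (cong (_* Φ (lastℕ m b)) (inv-distrib-* (ι m) (prodℚ (map ι b))))
          (ℚP.*-assoc (inv (ι m)) (inv (prodℚ (map ι b))) (Φ (lastℕ m b))))
        (sym (*-distribˡ-∑ (inv (ι m)) (weakChains m j N) _)))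

    ∑-binom-starSum : ∀ Φ j n →
      inv (powℚ (ι (suc n)) j) * (∑[ m ∈ suc n ⋯ N ] binom (ι (m ∸ 1)) n * Φ m)
        ≡ ∑[ m ∈ suc n ⋯ N ] binom (ι (m ∸ 1)) n * starSum j Φ m
    ∑-binom-starSum Φ zero n = trans (ℚP.*-identityˡ _)
      (∑ᵣ-cong (suc n) N λ m _ _ → cong (binom (ι (m ∸ 1)) n *_) (sym (starSum-zero Φ m)))
    ∑-binom-starSum Φ (suc j) n = begin
      inv (ι (suc n) * powℚ (ι (suc n)) j) * X
        ≡⟨ cong (_* X) (inv-distrib-* (ι (suc n)) _) ⟩
      inv (ι (suc n)) * inv (powℚ (ι (suc n)) j) * X
        ≡⟨ ℚP.*-assoc (inv (ι (suc n))) _ X ⟩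
      inv (ι (suc n)) * (inv (powℚ (ι (suc n)) j) * X)
        ≡⟨ cong (inv (ι (suc n)) *_) (∑-binom-starSum Φ j n) ⟩
      inv (ι (suc n)) * (∑[ m ∈ suc n ⋯ N ] bin m * W m)
        ≡⟨ *-distribˡ-∑ (inv (ι (suc n))) (range (suc n) N) _ ⟩
      ∑[ m ∈ suc n ⋯ N ] inv (ι (suc n)) * (bin m * W m)
        ≡⟨ ∑ᵣ-cong (suc n) N (λ { (suc m) _ _ → absorbed m }) ⟩
      ∑[ m ∈ suc n ⋯ N ] binom (ι m) (suc n) * (inv (ι m) * W m)
        ≡⟨ ∑ᵣ-cong (suc n) N (λ m n<m _ → cong (_* (inv (ι m) * W m)) (sym (hockey-stick n m (ℕP.<⇒≤ n<m)))) ⟩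
      ∑[ m ∈ suc n ⋯ N ] (∑[ m′ ∈ suc n ⋯ m ] bin m′) * (inv (ι m) * W m)
        ≡⟨ ∑ᵣ-cong (suc n) N (λ m _ _ → *-distribʳ-∑ (inv (ι m) * W m) (range (suc n) m) bin) ⟩
      ∑[ m ∈ suc n ⋯ N ] ∑[ m′ ∈ suc n ⋯ m ] bin m′ * (inv (ι m) * W m)
        ≡⟨ sym (∑ᵣ-interchange (suc n) N (λ m′ m → bin m′ * (inv (ι m) * W m))) ⟩
      ∑[ m′ ∈ suc n ⋯ N ] ∑[ m ∈ m′ ⋯ N ] bin m′ * (inv (ι m) * W m)
        ≡⟨ ∑ᵣ-cong (suc n) N (λ m′ _ _ → sym (*-distribˡ-∑ (bin m′) (range m′ N) _)) ⟩
      ∑[ m′ ∈ suc n ⋯ N ] bin m′ * (∑[ m ∈ m′ ⋯ N ] inv (ι m) * W m)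
        ≡⟨ ∑ᵣ-cong (suc n) N (λ m′ _ _ → cong (bin m′ *_) (sym (starSum-suc j Φ m′))) ⟩
      ∑[ m′ ∈ suc n ⋯ N ] bin m′ * starSum (suc j) Φ m′
        ∎
      where
      bin : ℕ → ℚ
      bin m = binom (ι (m ∸ 1)) n
      W : ℕ → ℚ
      W = starSum j Φ
      X : ℚ
      X = ∑[ m ∈ suc n ⋯ N ] bin m * Φ m
      absorbed : ∀ m → inv (ι (suc n)) * (binom (ι m) n * W (suc m))
                       ≡ binom (ι (suc m)) (suc n) * (inv (ι (suc m)) * W (suc m))
      absorbed m = begin
        inv (ι (suc n)) * (binom (ι m) n * W (suc m))                 ≡⟨ sym (ℚP.*-assoc (inv (ι (suc n))) _ _) ⟩
        inv (ι (suc n)) * binom (ι m) n * W (suc m)                   ≡⟨ cong (_* W (suc m)) (sym (binom-absorb m n)) ⟩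
        binom (ι (suc m)) (suc n) * inv (ι (suc m)) * W (suc m)       ≡⟨ ℚP.*-assoc (binom (ι (suc m)) (suc n)) _ _ ⟩
        binom (ι (suc m)) (suc n) * (inv (ι (suc m)) * W (suc m))     ∎

  module _ (N : ℕ) (z : ℚ) (z≢ι : ∀ j → 1 ≤ j → j ≤ N → z ≢ ι j) where

    private
      y : ℚ
      y = z - 1ℚ

      z-ι≢0 : ∀ j → 1 ≤ j → j ≤ N → z - ι j ≢ 0ℚ
      z-ι≢0 j 1≤j j≤N eq = z≢ι j 1≤j j≤N (p-q≡0⇒p≡q z (ι j) eq)

      y-ι≡z-ι-suc : ∀ i → y - ι i ≡ z - ι (suc i)
      y-ι≡z-ι-suc i = trans (solve 2 (λ z i → z :- con 1ℚ :- i := z :- (con 1ℚ :+ i)) refl z (ι i))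
                            (cong (λ u → z - u) (sym (ι-suc i)))

      y-ι≢0 : ∀ i → i < N → y - ι i ≢ 0ℚ
      y-ι≢0 i i<N = subst (_≢ 0ℚ) (sym (y-ι≡z-ι-suc i)) (z-ι≢0 (suc i) (s≤s z≤n) i<N)

      quotient : ℕ → ℕ → ℚ
      quotient m n = binom (ι m) (n ∸ 1) * inv (binom y (n ∸ 1)) * inv (z - ι (suc m))

      quotient-difference : ∀ m j → j ≤ m → suc m ≤ N →
        inv (ι (suc j)) * inv (binom y (suc j)) * binom (ι m) j ≡ quotient m (suc j) - quotient m (suc (suc j))
      quotient-difference m j j≤m m<N = trans lhs≡ (sym rhs≡)
        where
        B = binom (ι m) j
        iC = inv (binom y j)
        D = y - ι j
        E = z - ι (suc m)
        w = ι m - ι j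
        J = ι (suc j)
        D≢0 : D ≢ 0ℚ
        D≢0 = y-ι≢0 j (ℕP.<-≤-trans (s≤s j≤m) m<N)
        E≡D-w : E ≡ D - w
        E≡D-w = trans (sym (y-ι≡z-ι-suc m)) (solve 3 (λ y a b → y :- a := (y :- b) :- (a :- b)) refl y (ι m) (ι j))
        lhs≡ : inv J * inv (binom y (suc j)) * B ≡ B * iC * inv D
        lhs≡ = begin
          inv J * inv (binom y (suc j)) * B  ≡⟨ cong (λ u → inv J * u * B) (inv-binom-suc y j) ⟩
          inv J * (iC * inv D * J) * B      ≡⟨ solve 5 (λ B iC iD J iJ → iJ :* (iC :* iD :* J) :* B := (J :* iJ) :* (B :* iC :* iD))
                                                 refl B iC (inv D) J (inv J) ⟩
          J * inv J * (B * iC * inv D)      ≡⟨ cong (_* (B * iC * inv D)) (*-invʳ J (ι-suc≢0 j)) ⟩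
          1ℚ * (B * iC * inv D)             ≡⟨ ℚP.*-identityˡ _ ⟩
          B * iC * inv D                    ∎
        rhs≡ : quotient m (suc j) - quotient m (suc (suc j)) ≡ B * iC * inv D
        rhs≡ = begin
          B * iC * inv E - binom (ι m) (suc j) * inv (binom y (suc j)) * inv E
            ≡⟨ cong₂ (λ u v → B * iC * inv E - u * v * inv E) (binom-suc (ι m) j) (inv-binom-suc y j) ⟩
          B * iC * inv E - B * w * inv J * (iC * inv D * J) * inv E
            ≡⟨ solve 8 (λ B iC D iD iE w J iJ → B :* iC :* iE :- B :* w :* iJ :* (iC :* iD :* J) :* iE
                        := B :* iC :* iE :* con 1ℚ :- (J :* iJ) :* (B :* w :* iC :* iD :* iE))
                 refl B iC D (inv D) (inv E) w J (inv J) ⟩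
          B * iC * inv E * 1ℚ - J * inv J * (B * w * iC * inv D * inv E)
            ≡⟨ cong₂ (λ u v → B * iC * inv E * u - v * (B * w * iC * inv D * inv E))
                 (sym (*-invʳ D D≢0)) (*-invʳ J (ι-suc≢0 j)) ⟩
          B * iC * inv E * (D * inv D) - 1ℚ * (B * w * iC * inv D * inv E)
            ≡⟨ solve 7 (λ B iC D iD iE w E → B :* iC :* iE :* (D :* iD) :- con 1ℚ :* (B :* w :* iC :* iD :* iE)
                        := B :* iC :* iD :* ((D :- w) :* iE))
                 refl B iC D (inv D) (inv E) w E ⟩
          B * iC * inv D * ((D - w) * inv E)
            ≡⟨ cong (λ u → B * iC * inv D * (u * inv E)) (sym E≡D-w) ⟩
          B * iC * inv D * (E * inv E)
            ≡⟨ cong (B * iC * inv D *_) (*-invʳ E (z-ι≢0 (suc m) (s≤s z≤n) m<N)) ⟩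
          B * iC * inv D * 1ℚ
            ≡⟨ ℚP.*-identityʳ _ ⟩
          B * iC * inv D
            ∎

    ∑-binom-quotient : ∀ a m → a ≤ m → suc m ≤ N →
      ∑[ n ∈ suc a ⋯ suc m ] binom (z - 1ℚ) a * (inv (ι n) * inv (binom (z - 1ℚ) n) * binom (ι m) (n ∸ 1))
        ≡ binom (ι m) a * inv (z - ι (suc m))
    ∑-binom-quotient a m a≤m m<N = begin
      ∑[ n ∈ suc a ⋯ suc m ] binom y a * (inv (ι n) * inv (binom y n) * binom (ι m) (n ∸ 1))
        ≡⟨ ∑ᵣ-cong (suc a) (suc m) (λ { (suc j) _ (s≤s j≤m) → cong (binom y a *_) (quotient-difference m j j≤m m<N) }) ⟩
      ∑[ n ∈ suc a ⋯ suc m ] binom y a * (quotient m n - quotient m (suc n))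
        ≡⟨ sym (*-distribˡ-∑ (binom y a) (range (suc a) (suc m)) _) ⟩
      binom y a * (∑[ n ∈ suc a ⋯ suc m ] (quotient m n - quotient m (suc n)))
        ≡⟨ cong (binom y a *_) (∑ᵣ-telescope (quotient m) (s≤s (ℕP.m≤n⇒m≤1+n a≤m))) ⟩
      binom y a * (quotient m (suc a) - quotient m (suc (suc m)))
        ≡⟨ cong (λ u → binom y a * (quotient m (suc a) - u * inv (binom y (suc m)) * inv E)) (binom[m,1+m]≡0 m) ⟩
      binom y a * (binom (ι m) a * inv (binom y a) * inv E - 0ℚ * inv (binom y (suc m)) * inv E)
        ≡⟨ solve 5 (λ b B ib iE X → b :* (B :* ib :* iE :- con 0ℚ :* X :* iE) := (b :* ib) :* (B :* iE))
             refl (binom y a) (binom (ι m) a) (inv (binom y a)) (inv E) (inv (binom y (suc m))) ⟩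
      binom y a * inv (binom y a) * (binom (ι m) a * inv E)
        ≡⟨ cong (_* (binom (ι m) a * inv E)) (*-invʳ (binom y a) (binom≢0 y a y-ι≢0′)) ⟩
      1ℚ * (binom (ι m) a * inv E)
        ≡⟨ ℚP.*-identityˡ _ ⟩
      binom (ι m) a * inv E
        ∎
      where
      E = z - ι (suc m)
      y-ι≢0′ : ∀ i → i < a → y - ι i ≢ 0ℚ
      y-ι≢0′ i i<a = y-ι≢0 i (ℕP.<-≤-trans i<a (ℕP.≤-trans a≤m (ℕP.<⇒≤ m<N)))

    ∑-inv-pow-binom : ∀ Φ k a →
      ∑[ n ∈ suc a ⋯ N ] inv (powℚ (ι n) (suc k)) * binom (z - 1ℚ) a * inv (binom (z - 1ℚ) n)
                           * (∑[ m ∈ n ⋯ N ] binom (ι (m ∸ 1)) (n ∸ 1) * Φ m)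
        ≡ ∑[ m ∈ suc a ⋯ N ] binom (ι (m ∸ 1)) a * inv (z - ι m) * starSum N k Φ m
    ∑-inv-pow-binom Φ k a = begin
      ∑[ n ∈ suc a ⋯ N ] inv (powℚ (ι n) (suc k)) * binom y a * inv (binom y n) * (∑[ m ∈ n ⋯ N ] bin n m * Φ m)
        ≡⟨ ∑ᵣ-cong (suc a) N (λ { (suc n) _ _ → expand n }) ⟩
      ∑[ n ∈ suc a ⋯ N ] ∑[ m ∈ n ⋯ N ] G n m
        ≡⟨ ∑ᵣ-interchange (suc a) N G ⟩
      ∑[ m ∈ suc a ⋯ N ] ∑[ n ∈ suc a ⋯ m ] G n m
        ≡⟨ ∑ᵣ-cong (suc a) N (λ m _ _ → sym (*-distribʳ-∑ (W m) (range (suc a) m) (λ n → q n m))) ⟩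
      ∑[ m ∈ suc a ⋯ N ] (∑[ n ∈ suc a ⋯ m ] q n m) * W m
        ≡⟨ ∑ᵣ-cong (suc a) N (λ { (suc m) (s≤s a≤m) m<N → cong (_* W (suc m)) (∑-binom-quotient a m a≤m m<N) }) ⟩
      ∑[ m ∈ suc a ⋯ N ] binom (ι (m ∸ 1)) a * inv (z - ι m) * W m
        ∎
      where
      W : ℕ → ℚ
      W = starSum N k Φ
      bin : ℕ → ℕ → ℚ
      bin n m = binom (ι (m ∸ 1)) (n ∸ 1)
      q : ℕ → ℕ → ℚ
      q n m = binom y a * (inv (ι n) * inv (binom y n) * bin n m)
      G : ℕ → ℕ → ℚ
      G n m = q n m * W m
      expand : ∀ n →
        inv (powℚ (ι (suc n)) (suc k)) * binom y a * inv (binom y (suc n)) * (∑[ m ∈ suc n ⋯ N ] bin (suc n) m * Φ m)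
          ≡ ∑[ m ∈ suc n ⋯ N ] G (suc n) m
      expand n = begin
        inv (ι (suc n) * powℚ (ι (suc n)) k) * binom y a * c * X
          ≡⟨ cong (λ u → u * binom y a * c * X) (inv-distrib-* (ι (suc n)) _) ⟩
        inv (ι (suc n)) * inv (powℚ (ι (suc n)) k) * binom y a * c * X
          ≡⟨ solve 5 (λ i p b c X → i :* p :* b :* c :* X := b :* (i :* c) :* (p :* X)) refl
               (inv (ι (suc n))) (inv (powℚ (ι (suc n)) k)) (binom y a) c X ⟩
        binom y a * (inv (ι (suc n)) * c) * (inv (powℚ (ι (suc n)) k) * X)
          ≡⟨ cong (binom y a * (inv (ι (suc n)) * c) *_) (∑-binom-starSum N Φ k n) ⟩
        binom y a * (inv (ι (suc n)) * c) * (∑[ m ∈ suc n ⋯ N ] bin (suc n) m * W m)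
          ≡⟨ *-distribˡ-∑ (binom y a * (inv (ι (suc n)) * c)) (range (suc n) N) _ ⟩
        ∑[ m ∈ suc n ⋯ N ] binom y a * (inv (ι (suc n)) * c) * (bin (suc n) m * W m)
          ≡⟨ ∑ᵣ-cong (suc n) N (λ m _ _ → solve 5 (λ b i c B w → b :* (i :* c) :* (B :* w) := b :* (i :* c :* B) :* w)
               refl (binom y a) (inv (ι (suc n))) c (bin (suc n) m) (W m)) ⟩
        ∑[ m ∈ suc n ⋯ N ] G (suc n) m
          ∎
        where
        c = inv (binom y (suc n))
        X = ∑[ m ∈ suc n ⋯ N ] bin (suc n) m * Φ m

  take-length-++ : ∀ (xs ys : List A) → take (length xs) (xs ++ ys) ≡ xs
  take-length-++ []       ys = refl
  take-length-++ (x ∷ xs) ys = cong (x ∷_) (take-length-++ xs ys)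

  drop-length-++ : ∀ (xs ys : List A) → drop (length xs) (xs ++ ys) ≡ ys
  drop-length-++ []       ys = refl
  drop-length-++ (x ∷ xs) ys = drop-length-++ xs ys

  split-at : ∀ r (xs : List A) s → length xs ≡ r ℕ.+ suc s →
    ∃[ xa ] ∃[ x ] ∃[ xb ] xs ≡ xa ++ x ∷ xb × length xa ≡ r × length xb ≡ s
  split-at zero    (x ∷ xs) s eq = [] , x , xs , refl , refl , ℕP.suc-injective eq
  split-at (suc r) (y ∷ xs) s eq with split-at r xs s (ℕP.suc-injective eq)
  ... | xa , x , xb , refl , refl , eqb = y ∷ xa , x , xb , refl , refl , eqb

  Admissible₁ : ℕ → ℚ → Set
  Admissible₁ N x = ∀ j → 1 ≤ j → j ≤ N → ι N * x ≢ ι j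

  Admissible-++-∷ : ∀ {N} xa {x xb} → Admissible N (xa ++ x ∷ xb) → Admissible₁ N x
  Admissible-++-∷ []       (x-admissible ∷ _) = x-admissible
  Admissible-++-∷ (_ ∷ xa) (_ ∷ admissible)   = Admissible-++-∷ xa admissible

  module _ (N : ℕ) where

    binomRatio : ℚ → ℚ → ℕ → ℚ
    binomRatio x x′ n = binom (ι N * x′ - 1ℚ) n * inv (binom (ι N * x - 1ℚ) n)

    chainSum : ℕ → List ℕ → List ℚ → (ℚ → ℕ → ℚ) → ℚ
    chainSum lo ks xs T = ∑[ ns ∈ incChains lo (length ks) N ] Qk N ks xs ns * T (lastℚ xs) (lastℕ lo ns)

    Qk-cons : ∀ k₁ k₂ ks x₁ x₂ xs a b ns →
      Qk N (k₁ ∷ k₂ ∷ ks) (x₁ ∷ x₂ ∷ xs) (a ∷ b ∷ ns)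
        ≡ inv (powℚ (ι a) k₁) * binomRatio x₁ x₂ a * Qk N (k₂ ∷ ks) (x₂ ∷ xs) (b ∷ ns)
    Qk-cons k₁ k₂ ks x₁ x₂ xs a b ns = begin
      inv (powℚ (ι a) k₁ * P) * (binomRatio x₁ x₂ a * R)
        ≡⟨ cong (_* (binomRatio x₁ x₂ a * R)) (inv-distrib-* (powℚ (ι a) k₁) P) ⟩
      inv (powℚ (ι a) k₁) * inv P * (binomRatio x₁ x₂ a * R)
        ≡⟨ solve 4 (λ p q r R → p :* q :* (r :* R) := p :* r :* (q :* R)) refl
             (inv (powℚ (ι a) k₁)) (inv P) (binomRatio x₁ x₂ a) R ⟩
      inv (powℚ (ι a) k₁) * binomRatio x₁ x₂ a * (inv P * R)
        ∎
      where
      P = prodℚ (zipWith (λ n k → powℚ (ι n) k) (b ∷ ns) (k₂ ∷ ks))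
      R = ratios N (b ∷ ns) (x₂ ∷ xs)

    Qk-singleton : ∀ k x n → Qk N [ k ] [ x ] [ n ] ≡ inv (powℚ (ι n) k)
    Qk-singleton k x n = trans (ℚP.*-identityʳ (inv (powℚ (ι n) k * 1ℚ))) (cong inv (ℚP.*-identityʳ (powℚ (ι n) k)))

    chainSum-singleton : ∀ lo k x T → chainSum lo [ k ] [ x ] T ≡ ∑[ a ∈ suc lo ⋯ N ] inv (powℚ (ι a) k) * T x a
    chainSum-singleton lo k x T = trans (∑-concatMap-∷ (λ a → [ [] ]) (range (suc lo) N) _)
      (∑ᵣ-cong (suc lo) N λ a _ _ → trans (ℚP.+-identityʳ _) (cong (_* T x a) (Qk-singleton k x a)))

    chainSum-cons : ∀ lo k₁ k₂ ks x₁ x₂ xs T →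
      chainSum lo (k₁ ∷ k₂ ∷ ks) (x₁ ∷ x₂ ∷ xs) T
        ≡ ∑[ a ∈ suc lo ⋯ N ] inv (powℚ (ι a) k₁) * binomRatio x₁ x₂ a * chainSum a (k₂ ∷ ks) (x₂ ∷ xs) T
    chainSum-cons lo k₁ k₂ ks x₁ x₂ xs T = begin
      chainSum lo (k₁ ∷ k₂ ∷ ks) (x₁ ∷ x₂ ∷ xs) T
        ≡⟨ ∑-concatMap-∷ (λ a → incChains a (suc (length ks)) N) (range (suc lo) N) _ ⟩
      ∑[ a ∈ suc lo ⋯ N ] ∑[ ns ∈ incChains a (suc (length ks)) N ] Qk N (k₁ ∷ k₂ ∷ ks) (x₁ ∷ x₂ ∷ xs) (a ∷ ns) * T′ a ns
        ≡⟨ ∑ᵣ-cong (suc lo) N (λ a _ _ → ∑-concatMap-∷-cong (λ b → incChains b (length ks) N) (range (suc a) N)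
             (λ b ns → trans (cong (_* T′ b ns) (Qk-cons k₁ k₂ ks x₁ x₂ xs a b ns))
                             (ℚP.*-assoc (c a) (Qk N (k₂ ∷ ks) (x₂ ∷ xs) (b ∷ ns)) (T′ b ns)))) ⟩
      ∑[ a ∈ suc lo ⋯ N ] ∑[ ns ∈ incChains a (suc (length ks)) N ] c a * (Qk N (k₂ ∷ ks) (x₂ ∷ xs) ns * T′ a ns)
        ≡⟨ ∑ᵣ-cong (suc lo) N (λ a _ _ → sym (*-distribˡ-∑ (c a) (incChains a (suc (length ks)) N) _)) ⟩
      ∑[ a ∈ suc lo ⋯ N ] c a * chainSum a (k₂ ∷ ks) (x₂ ∷ xs) T
        ∎
      where
      c : ℕ → ℚ
      c a = inv (powℚ (ι a) k₁) * binomRatio x₁ x₂ a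
      T′ : ℕ → List ℕ → ℚ
      T′ a ns = T (lastℚ (x₂ ∷ xs)) (lastℕ a ns)

    chainSum-snoc : ∀ k ks xs x′ T T′ → length xs ≡ length ks → ks ≢ [] →
      (∀ x a → ∑[ n ∈ suc a ⋯ N ] inv (powℚ (ι n) k) * binomRatio x x′ a * T x′ n ≡ T′ x a) →
      ∀ lo → chainSum lo (ks ++ [ k ]) (xs ++ [ x′ ]) T ≡ chainSum lo ks xs T′
    chainSum-snoc k []        _              x′ T T′ _  []≢[] _         lo = ⊥-elim ([]≢[] refl)
    chainSum-snoc k (k₁ ∷ []) (x₁ ∷ [])      x′ T T′ _  _     transfers lo = begin
      chainSum lo (k₁ ∷ k ∷ []) (x₁ ∷ x′ ∷ []) T
        ≡⟨ chainSum-cons lo k₁ k [] x₁ x′ [] T ⟩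
      ∑[ a ∈ suc lo ⋯ N ] inv (powℚ (ι a) k₁) * binomRatio x₁ x′ a * chainSum a [ k ] [ x′ ] T
        ≡⟨ ∑ᵣ-cong (suc lo) N (λ a _ _ →
             trans (ℚP.*-assoc (inv (powℚ (ι a) k₁)) _ _) (cong (inv (powℚ (ι a) k₁) *_) (sum-out-last a))) ⟩
      ∑[ a ∈ suc lo ⋯ N ] inv (powℚ (ι a) k₁) * T′ x₁ a
        ≡⟨ sym (chainSum-singleton lo k₁ x₁ T′) ⟩
      chainSum lo [ k₁ ] [ x₁ ] T′
        ∎
      where
      sum-out-last : ∀ a → binomRatio x₁ x′ a * chainSum a [ k ] [ x′ ] T ≡ T′ x₁ a
      sum-out-last a = begin
        binomRatio x₁ x′ a * chainSum a [ k ] [ x′ ] T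
          ≡⟨ cong (binomRatio x₁ x′ a *_) (chainSum-singleton a k x′ T) ⟩
        binomRatio x₁ x′ a * (∑[ n ∈ suc a ⋯ N ] inv (powℚ (ι n) k) * T x′ n)
          ≡⟨ *-distribˡ-∑ (binomRatio x₁ x′ a) (range (suc a) N) _ ⟩
        ∑[ n ∈ suc a ⋯ N ] binomRatio x₁ x′ a * (inv (powℚ (ι n) k) * T x′ n)
          ≡⟨ ∑ᵣ-cong (suc a) N (λ n _ _ → solve 3 (λ r p t → r :* (p :* t) := p :* r :* t) refl
               (binomRatio x₁ x′ a) (inv (powℚ (ι n) k)) (T x′ n)) ⟩
        ∑[ n ∈ suc a ⋯ N ] inv (powℚ (ι n) k) * binomRatio x₁ x′ a * T x′ n
          ≡⟨ transfers x₁ a ⟩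
        T′ x₁ a
          ∎
    chainSum-snoc k (k₁ ∷ k₂ ∷ ks) (x₁ ∷ x₂ ∷ xs) x′ T T′ eq _ transfers lo = begin
      chainSum lo (k₁ ∷ k₂ ∷ ks ++ [ k ]) (x₁ ∷ x₂ ∷ xs ++ [ x′ ]) T
        ≡⟨ chainSum-cons lo k₁ k₂ (ks ++ [ k ]) x₁ x₂ (xs ++ [ x′ ]) T ⟩
      ∑[ a ∈ suc lo ⋯ N ] inv (powℚ (ι a) k₁) * binomRatio x₁ x₂ a * chainSum a (k₂ ∷ ks ++ [ k ]) (x₂ ∷ xs ++ [ x′ ]) T
        ≡⟨ ∑ᵣ-cong (suc lo) N (λ a _ _ → cong (inv (powℚ (ι a) k₁) * binomRatio x₁ x₂ a *_)
             (chainSum-snoc k (k₂ ∷ ks) (x₂ ∷ xs) x′ T T′ (ℕP.suc-injective eq) (λ ()) transfers a)) ⟩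
      ∑[ a ∈ suc lo ⋯ N ] inv (powℚ (ι a) k₁) * binomRatio x₁ x₂ a * chainSum a (k₂ ∷ ks) (x₂ ∷ xs) T′
        ≡⟨ sym (chainSum-cons lo k₁ k₂ ks x₁ x₂ xs T′) ⟩
      chainSum lo (k₁ ∷ k₂ ∷ ks) (x₁ ∷ x₂ ∷ xs) T′
        ∎
    chainSum-snoc k (_ ∷ [])     (_ ∷ _ ∷ _) _ _ _ ()
    chainSum-snoc k (_ ∷ _ ∷ _) (_ ∷ [])     _ _ _ ()
    chainSum-snoc k (_ ∷ _)      []          _ _ _ ()

    blockSum : List ℚ → List ℕ → ℕ → ℚ
    blockSum xs ls lo = ∑[ ms ∈ blocks lo ls N ] prodℚ (zipWith (PN N) xs ms)

    blockSumAt : List ℚ → ℕ → List ℕ → ℕ → ℚ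
    blockSumAt xs l ls M =
      ∑[ b ∈ weakChains M l N ] ∑[ ms ∈ blocks (lastℕ M b) ls N ] prodℚ (zipWith (PN N) xs ((M ∷ b) ∷ ms))

    tailSum : List ℚ → List ℕ → ℚ → ℕ → ℚ
    tailSum xs ls x n = ∑[ ms ∈ blocks n ls N ] Conn N x n (headBlock ms ∸ 1) * prodℚ (zipWith (PN N) xs ms)

    endConn : ℚ → ℕ → ℚ
    endConn x n = binom (ι N) n * inv (binom (ι N * x - 1ℚ) n)

    ∑-blocks-by-head : ∀ xs l ls lo (g : ℕ → ℚ) →
      ∑[ ms ∈ blocks lo (suc l ∷ ls) N ] g (headBlock ms) * prodℚ (zipWith (PN N) xs ms)
        ≡ ∑[ M ∈ suc lo ⋯ N ] g M * blockSumAt xs l ls M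
    ∑-blocks-by-head xs l ls lo g = begin
      ∑[ ms ∈ blocks lo (suc l ∷ ls) N ] f ms
        ≡⟨ ∑-concatMap-∷ (λ b → blocks (lastℕ lo b) ls N) (weakChains (suc lo) (suc l) N) f ⟩
      ∑[ b ∈ weakChains (suc lo) (suc l) N ] ∑[ ms ∈ blocks (lastℕ lo b) ls N ] f (b ∷ ms)
        ≡⟨ ∑-concatMap-∷ (λ M → weakChains M l N) (range (suc lo) N) _ ⟩
      ∑[ M ∈ suc lo ⋯ N ] ∑[ b ∈ weakChains M l N ] ∑[ ms ∈ blocks (lastℕ M b) ls N ] f ((M ∷ b) ∷ ms)
        ≡⟨ ∑ᵣ-cong (suc lo) N (λ M _ _ → trans
             (∑-cong (weakChains M l N) λ b → sym (*-distribˡ-∑ (g M) (blocks (lastℕ M b) ls N) _))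
             (sym (*-distribˡ-∑ (g M) (weakChains M l N) _))) ⟩
      ∑[ M ∈ suc lo ⋯ N ] g M * blockSumAt xs l ls M
        ∎
      where
      f : List (List ℕ) → ℚ
      f ms = g (headBlock ms) * prodℚ (zipWith (PN N) xs ms)

    blockSum≡∑-blockSumAt : ∀ xs l ls m → blockSum xs (suc l ∷ ls) m ≡ ∑[ M ∈ suc m ⋯ N ] blockSumAt xs l ls M
    blockSum≡∑-blockSumAt xs l ls m = begin
      blockSum xs (suc l ∷ ls) m
        ≡⟨ ∑-cong (blocks m (suc l ∷ ls) N) (λ ms → sym (ℚP.*-identityˡ _)) ⟩
      ∑[ ms ∈ blocks m (suc l ∷ ls) N ] 1ℚ * prodℚ (zipWith (PN N) xs ms)
        ≡⟨ ∑-blocks-by-head xs l ls m (λ _ → 1ℚ) ⟩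
      ∑[ M ∈ suc m ⋯ N ] 1ℚ * blockSumAt xs l ls M
        ≡⟨ ∑ᵣ-cong (suc m) N (λ M _ _ → ℚP.*-identityˡ _) ⟩
      ∑[ M ∈ suc m ⋯ N ] blockSumAt xs l ls M
        ∎

    ∑-binom-blocks : ∀ xs l ls n →
      ∑[ ms ∈ blocks (suc n) (suc l ∷ ls) N ] binom (ι (headBlock ms ∸ 1)) (suc n) * prodℚ (zipWith (PN N) xs ms)
        ≡ ∑[ m ∈ suc n ⋯ N ] binom (ι (m ∸ 1)) n * blockSum xs (suc l ∷ ls) m
    ∑-binom-blocks xs l ls n = begin
      ∑[ ms ∈ blocks (suc n) (suc l ∷ ls) N ] binom (ι (headBlock ms ∸ 1)) (suc n) * prodℚ (zipWith (PN N) xs ms)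
        ≡⟨ ∑-blocks-by-head xs l ls (suc n) (λ M → binom (ι (M ∸ 1)) (suc n)) ⟩
      ∑[ M ∈ suc (suc n) ⋯ N ] binom (ι (M ∸ 1)) (suc n) * ψ M
        ≡⟨ ∑ᵣ-cong (suc (suc n)) N
             (λ { (suc M) (s≤s n<M) _ → cong (_* ψ (suc M)) (sym (hockey-stick n M (ℕP.<⇒≤ n<M))) }) ⟩
      ∑[ M ∈ suc (suc n) ⋯ N ] (∑[ m ∈ suc n ⋯ pred M ] bin m) * ψ M
        ≡⟨ ∑ᵣ-cong (suc (suc n)) N (λ M _ _ → *-distribʳ-∑ (ψ M) (range (suc n) (pred M)) bin) ⟩
      ∑[ M ∈ suc (suc n) ⋯ N ] ∑[ m ∈ suc n ⋯ pred M ] bin m * ψ M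
        ≡⟨ sym (∑ᵣ-interchange-strict (suc n) N (λ m M → bin m * ψ M)) ⟩
      ∑[ m ∈ suc n ⋯ N ] ∑[ M ∈ suc m ⋯ N ] bin m * ψ M
        ≡⟨ ∑ᵣ-cong (suc n) N (λ m _ _ → trans (sym (*-distribˡ-∑ (bin m) (range (suc m) N) ψ))
             (cong (bin m *_) (sym (blockSum≡∑-blockSumAt xs l ls m)))) ⟩
      ∑[ m ∈ suc n ⋯ N ] bin m * blockSum xs (suc l ∷ ls) m
        ∎
      where
      bin : ℕ → ℚ
      bin m = binom (ι (m ∸ 1)) n
      ψ : ℕ → ℚ
      ψ = blockSumAt xs l ls

    tailSum≡inv-binom*∑ : ∀ xs ls x n →
      tailSum xs ls x n
        ≡ inv (binom (ι N * x - 1ℚ) n)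
            * (∑[ ms ∈ blocks n ls N ] binom (ι (headBlock ms ∸ 1)) n * prodℚ (zipWith (PN N) xs ms))
    tailSum≡inv-binom*∑ xs ls x n = trans
      (∑-cong (blocks n ls N) λ ms → solve 3 (λ B i P → B :* i :* P := i :* (B :* P)) refl
        (binom (ι (headBlock ms ∸ 1)) n) (inv (binom (ι N * x - 1ℚ) n)) (prodℚ (zipWith (PN N) xs ms)))
      (sym (*-distribˡ-∑ (inv (binom (ι N * x - 1ℚ) n)) (blocks n ls N) _))

    tailSum-cons : ∀ x′ xs k ls x a →
      tailSum (x′ ∷ xs) (k ∷ ls) x a
        ≡ ∑[ b ∈ weakChains (suc a) k N ] Conn N x a (headℕ b ∸ 1) * (PN N x′ b * blockSum xs ls (lastℕ a b))
    tailSum-cons x′ xs k ls x a = trans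
      (∑-concatMap-∷ (λ b → blocks (lastℕ a b) ls N) (weakChains (suc a) k N) _)
      (∑-cong (weakChains (suc a) k N) λ b → begin
        ∑[ ms ∈ blocks (lastℕ a b) ls N ] C b * (PN N x′ b * P ms)
          ≡⟨ ∑-cong (blocks (lastℕ a b) ls N) (λ ms → sym (ℚP.*-assoc (C b) (PN N x′ b) (P ms))) ⟩
        ∑[ ms ∈ blocks (lastℕ a b) ls N ] C b * PN N x′ b * P ms
          ≡⟨ sym (*-distribˡ-∑ (C b * PN N x′ b) (blocks (lastℕ a b) ls N) P) ⟩
        C b * PN N x′ b * blockSum xs ls (lastℕ a b)
          ≡⟨ ℚP.*-assoc (C b) (PN N x′ b) _ ⟩
        C b * (PN N x′ b * blockSum xs ls (lastℕ a b))
          ∎)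
      where
      C : List ℕ → ℚ
      C b = Conn N x a (headℕ b ∸ 1)
      P : List (List ℕ) → ℚ
      P ms = prodℚ (zipWith (PN N) xs ms)

    ∑-weakChains-Conn : ∀ x′ Φ k x a →
      ∑[ b ∈ weakChains (suc a) (suc k) N ] Conn N x a (headℕ b ∸ 1) * (PN N x′ b * Φ (lastℕ a b))
        ≡ inv (binom (ι N * x - 1ℚ) a)
            * (∑[ m ∈ suc a ⋯ N ] binom (ι (m ∸ 1)) a * inv (ι N * x′ - ι m) * starSum N k Φ m)
    ∑-weakChains-Conn x′ Φ k x a = begin
      ∑[ b ∈ weakChains (suc a) (suc k) N ] f b
        ≡⟨ ∑-concatMap-∷ (λ m → weakChains m k N) (range (suc a) N) f ⟩
      ∑[ m ∈ suc a ⋯ N ] ∑[ b ∈ weakChains m k N ] f (m ∷ b)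
        ≡⟨ ∑ᵣ-cong (suc a) N (λ m _ _ → trans (∑-cong (weakChains m k N) (factor m))
             (sym (*-distribˡ-∑ (c m) (weakChains m k N) _))) ⟩
      ∑[ m ∈ suc a ⋯ N ] c m * starSum N k Φ m
        ≡⟨ ∑ᵣ-cong (suc a) N (λ m _ _ → solve 4 (λ i B e w → i :* B :* e :* w := i :* (B :* e :* w)) refl
             ibx (binom (ι (m ∸ 1)) a) (inv (ι N * x′ - ι m)) (starSum N k Φ m)) ⟩
      ∑[ m ∈ suc a ⋯ N ] ibx * (binom (ι (m ∸ 1)) a * inv (ι N * x′ - ι m) * starSum N k Φ m)
        ≡⟨ sym (*-distribˡ-∑ ibx (range (suc a) N) _) ⟩
      ibx * (∑[ m ∈ suc a ⋯ N ] binom (ι (m ∸ 1)) a * inv (ι N * x′ - ι m) * starSum N k Φ m)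
        ∎
      where
      ibx = inv (binom (ι N * x - 1ℚ) a)
      f : List ℕ → ℚ
      f b = Conn N x a (headℕ b ∸ 1) * (PN N x′ b * Φ (lastℕ a b))
      c : ℕ → ℚ
      c m = ibx * binom (ι (m ∸ 1)) a * inv (ι N * x′ - ι m)
      factor : ∀ m b → f (m ∷ b) ≡ c m * (inv (prodℚ (map ι b)) * Φ (lastℕ m b))
      factor m b = trans
        (cong (λ u → Conn N x a (m ∸ 1) * (u * Φ (lastℕ m b))) (inv-distrib-* (ι N * x′ - ι m) (prodℚ (map ι b))))
        (solve 5 (λ B i e ip F → B :* i :* (e :* ip :* F) := i :* B :* e :* (ip :* F)) refl
          (binom (ι (m ∸ 1)) a) ibx (inv (ι N * x′ - ι m)) (inv (prodℚ (map ι b))) (Φ (lastℕ m b)))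

    module _ (x′ : ℚ) (x′-admissible : Admissible₁ N x′) where

      transfer : ∀ (Φ : ℕ → ℚ) (T : ℚ → ℕ → ℚ) k x a →
        (∀ n → n ≤ N →
           T x′ (suc n) ≡ inv (binom (ι N * x′ - 1ℚ) (suc n)) * (∑[ m ∈ suc n ⋯ N ] binom (ι (m ∸ 1)) n * Φ m)) →
        ∑[ n ∈ suc a ⋯ N ] inv (powℚ (ι n) (suc k)) * binomRatio x x′ a * T x′ n
          ≡ ∑[ b ∈ weakChains (suc a) (suc k) N ] Conn N x a (headℕ b ∸ 1) * (PN N x′ b * Φ (lastℕ a b))
      transfer Φ T k x a T-expansion = begin
        ∑[ n ∈ suc a ⋯ N ] inv (powℚ (ι n) (suc k)) * binomRatio x x′ a * T x′ n
          ≡⟨ ∑ᵣ-cong (suc a) N expand ⟩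
        ∑[ n ∈ suc a ⋯ N ] ibx * (inv (powℚ (ι n) (suc k)) * binom y a * inv (binom y n) * S n)
          ≡⟨ sym (*-distribˡ-∑ ibx (range (suc a) N) _) ⟩
        ibx * (∑[ n ∈ suc a ⋯ N ] inv (powℚ (ι n) (suc k)) * binom y a * inv (binom y n) * S n)
          ≡⟨ cong (ibx *_) (∑-inv-pow-binom N (ι N * x′) x′-admissible Φ k a) ⟩
        ibx * (∑[ m ∈ suc a ⋯ N ] binom (ι (m ∸ 1)) a * inv (ι N * x′ - ι m) * starSum N k Φ m)
          ≡⟨ sym (∑-weakChains-Conn x′ Φ k x a) ⟩
        ∑[ b ∈ weakChains (suc a) (suc k) N ] Conn N x a (headℕ b ∸ 1) * (PN N x′ b * Φ (lastℕ a b))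
          ∎
        where
        y = ι N * x′ - 1ℚ
        ibx = inv (binom (ι N * x - 1ℚ) a)
        S : ℕ → ℚ
        S n = ∑[ m ∈ n ⋯ N ] binom (ι (m ∸ 1)) (n ∸ 1) * Φ m
        expand : ∀ n → suc a ≤ n → n ≤ N →
          inv (powℚ (ι n) (suc k)) * binomRatio x x′ a * T x′ n
            ≡ ibx * (inv (powℚ (ι n) (suc k)) * binom y a * inv (binom y n) * S n)
        expand (suc n) _ n<N = trans (cong (inv (powℚ (ι (suc n)) (suc k)) * binomRatio x x′ a *_) (T-expansion n (ℕP.<⇒≤ n<N)))
          (solve 5 (λ p b i c s → p :* (b :* i) :* (c :* s) := i :* (p :* b :* c :* s)) refl
            (inv (powℚ (ι (suc n)) (suc k))) (binom y a) ibx (inv (binom y (suc n))) (S (suc n)))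

      tailSum-transfer : ∀ xs l ls k x a →
        ∑[ n ∈ suc a ⋯ N ] inv (powℚ (ι n) (suc k)) * binomRatio x x′ a * tailSum xs (suc l ∷ ls) x′ n
          ≡ tailSum (x′ ∷ xs) (suc k ∷ suc l ∷ ls) x a
      tailSum-transfer xs l ls k x a =
        trans (transfer (blockSum xs (suc l ∷ ls)) (tailSum xs (suc l ∷ ls)) k x a expansion)
              (sym (tailSum-cons x′ xs (suc k) (suc l ∷ ls) x a))
        where
        expansion : ∀ n → n ≤ N → tailSum xs (suc l ∷ ls) x′ (suc n)
          ≡ inv (binom (ι N * x′ - 1ℚ) (suc n)) * (∑[ m ∈ suc n ⋯ N ] binom (ι (m ∸ 1)) n * blockSum xs (suc l ∷ ls) m)
        expansion n _ = trans (tailSum≡inv-binom*∑ xs (suc l ∷ ls) x′ (suc n))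
          (cong (inv (binom (ι N * x′ - 1ℚ) (suc n)) *_) (∑-binom-blocks xs l ls n))

      endConn-transfer : ∀ k x a →
        ∑[ n ∈ suc a ⋯ N ] inv (powℚ (ι n) (suc k)) * binomRatio x x′ a * endConn x′ n
          ≡ tailSum [ x′ ] [ suc k ] x a
      -- blockSum [] [] m, the weight of the empty family of blocks, computes to 1ℚ.
      endConn-transfer k x a =
        trans (transfer (λ _ → 1ℚ) endConn k x a expansion) (sym (tailSum-cons x′ [] (suc k) [] x a))
        where
        expansion : ∀ n → n ≤ N → endConn x′ (suc n)
          ≡ inv (binom (ι N * x′ - 1ℚ) (suc n)) * (∑[ m ∈ suc n ⋯ N ] binom (ι (m ∸ 1)) n * 1ℚ)
        expansion n n≤N = trans (ℚP.*-comm (binom (ι N) (suc n)) (inv (binom (ι N * x′ - 1ℚ) (suc n))))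
          (cong (inv (binom (ι N * x′ - 1ℚ) (suc n)) *_)
            (trans (sym (hockey-stick n N n≤N)) (∑ᵣ-cong (suc n) N (λ m _ _ → sym (ℚP.*-identityʳ _)))))

    ∑-blocks-cons : ∀ (F : ℚ → List ℕ → ℚ) x xs l ls lo →
      ∑[ ms ∈ blocks lo (l ∷ ls) N ] prodℚ (zipWith F (x ∷ xs) ms)
        ≡ ∑[ b ∈ weakChains (suc lo) l N ] F x b * (∑[ ms ∈ blocks (lastℕ lo b) ls N ] prodℚ (zipWith F xs ms))
    ∑-blocks-cons F x xs l ls lo = trans
      (∑-concatMap-∷ (λ b → blocks (lastℕ lo b) ls N) (weakChains (suc lo) l N) _)
      (∑-cong (weakChains (suc lo) l N) λ b → sym (*-distribˡ-∑ (F x b) (blocks (lastℕ lo b) ls N) _))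

    Pneg≡-PN : ∀ x M b → Pneg N x (M ∷ b) ≡ - PN N x (M ∷ b)
    Pneg≡-PN x M b = trans
      (cong inv (solve 3 (λ m z p → (m :- z) :* p := :- ((z :- m) :* p)) refl (ι M) (ι N * x) (prodℚ (map ι b))))
      (inv-neg ((ι N * x - ι M) * prodℚ (map ι b)))

    ∑-prod-Pneg : ∀ ls xs → Index ls → length xs ≡ length ls → ∀ lo →
      ∑[ ms ∈ blocks lo ls N ] prodℚ (zipWith (Pneg N) xs ms) ≡ powℚ (- 1ℚ) (length ls) * blockSum xs ls lo
    ∑-prod-Pneg []           []       []          _   lo = sym (ℚP.*-identityˡ _)
    ∑-prod-Pneg (suc l ∷ ls) (x ∷ xs) (_ ∷ index) len lo = begin
      ∑[ ms ∈ blocks lo (suc l ∷ ls) N ] prodℚ (zipWith (Pneg N) (x ∷ xs) ms)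
        ≡⟨ ∑-blocks-cons (Pneg N) x xs (suc l) ls lo ⟩
      ∑[ b ∈ weakChains (suc lo) (suc l) N ] Pneg N x b * (∑[ ms ∈ blocks (lastℕ lo b) ls N ] prodℚ (zipWith (Pneg N) xs ms))
        ≡⟨ ∑-cong (weakChains (suc lo) (suc l) N)
             (λ b → cong (Pneg N x b *_) (∑-prod-Pneg ls xs index (ℕP.suc-injective len) (lastℕ lo b))) ⟩
      ∑[ b ∈ weakChains (suc lo) (suc l) N ] Pneg N x b * (σ * blockSum xs ls (lastℕ lo b))
        ≡⟨ ∑-concatMap-∷-cong (λ M → weakChains M l N) (range (suc lo) N) (λ M b → trans
             (cong (_* (σ * blockSum xs ls (lastℕ M b))) (Pneg≡-PN x M b))
             (solve 3 (λ p s B → (:- p) :* (s :* B) := (:- con 1ℚ :* s) :* (p :* B)) refl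
               (PN N x (M ∷ b)) σ (blockSum xs ls (lastℕ M b)))) ⟩
      ∑[ b ∈ weakChains (suc lo) (suc l) N ] - 1ℚ * σ * (PN N x b * blockSum xs ls (lastℕ lo b))
        ≡⟨ sym (*-distribˡ-∑ (- 1ℚ * σ) (weakChains (suc lo) (suc l) N) _) ⟩
      - 1ℚ * σ * (∑[ b ∈ weakChains (suc lo) (suc l) N ] PN N x b * blockSum xs ls (lastℕ lo b))
        ≡⟨ cong (- 1ℚ * σ *_) (sym (∑-blocks-cons (PN N) x xs (suc l) ls lo)) ⟩
      - 1ℚ * σ * blockSum (x ∷ xs) (suc l ∷ ls) lo
        ∎
      where
      σ = powℚ (- 1ℚ) (length ls)
    ∑-prod-Pneg (zero ∷ _) _       (() ∷ _)
    ∑-prod-Pneg []         (_ ∷ _) _        ()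
    ∑-prod-Pneg (_ ∷ _)    []      _        ()

    Z-k≡blockSum : ∀ xs ls → Index ls → length xs ≡ length ls → Z-k N xs ls ≡ blockSum xs ls 0
    Z-k≡blockSum xs ls index len = begin
      σ * (∑[ ms ∈ blocks 0 ls N ] prodℚ (zipWith (Pneg N) xs ms)) ≡⟨ cong (σ *_) (∑-prod-Pneg ls xs index len 0) ⟩
      σ * (σ * blockSum xs ls 0)                                   ≡⟨ sym (ℚP.*-assoc σ σ _) ⟩
      σ * σ * blockSum xs ls 0                                     ≡⟨ cong (_* blockSum xs ls 0) ([-1]^n*[-1]^n≡1 (length ls)) ⟩
      1ℚ * blockSum xs ls 0                                        ≡⟨ ℚP.*-identityˡ _ ⟩
      blockSum xs ls 0                                             ∎
      where
      σ = powℚ (- 1ℚ) (length ls)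
      [-1]^n*[-1]^n≡1 : ∀ n → powℚ (- 1ℚ) n * powℚ (- 1ℚ) n ≡ 1ℚ
      [-1]^n*[-1]^n≡1 zero    = refl
      [-1]^n*[-1]^n≡1 (suc n) = trans (solve 1 (λ p → (:- con 1ℚ :* p) :* (:- con 1ℚ :* p) := p :* p) refl (powℚ (- 1ℚ) n))
                                      ([-1]^n*[-1]^n≡1 n)

    -- Conn N x 0 m computes to 1ℚ.
    tailSum-zero : ∀ xs ls x → tailSum xs ls x 0 ≡ blockSum xs ls 0
    tailSum-zero xs ls x = ∑-cong (blocks 0 ls N) (λ ms → ℚP.*-identityˡ _)

    Zkl-split : ∀ xa xb ks ls → length xa ≡ length ks → Zkl N (xa ++ xb) ks ls ≡ chainSum 0 ks xa (tailSum xb ls)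
    Zkl-split xa xb ks ls eq = begin
      Zkl N (xa ++ xb) ks ls
        ≡⟨ sumℚ-concatMap _ (incChains 0 (length ks) N) ⟩
      ∑[ ns ∈ incChains 0 (length ks) N ] ∑[ ms ∈ blocks (lastℕ 0 ns) ls N ] Q ns * C ns ms * P ms
        ≡⟨ ∑-cong (incChains 0 (length ks) N) (λ ns → trans
             (∑-cong (blocks (lastℕ 0 ns) ls N) (λ ms → ℚP.*-assoc (Q ns) (C ns ms) (P ms)))
             (sym (*-distribˡ-∑ (Q ns) (blocks (lastℕ 0 ns) ls N) _))) ⟩
      chainSum 0 ks (take (length ks) (xa ++ xb)) (tailSum (drop (length ks) (xa ++ xb)) ls)
        ≡⟨ cong₂ (λ u v → chainSum 0 ks u (tailSum v ls)) take≡xa drop≡xb ⟩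
      chainSum 0 ks xa (tailSum xb ls)
        ∎
      where
      xs = xa ++ xb
      Q : List ℕ → ℚ
      Q = Qk N ks (take (length ks) xs)
      C : List ℕ → List (List ℕ) → ℚ
      C ns ms = Conn N (lastℚ (take (length ks) xs)) (lastℕ 0 ns) (headBlock ms ∸ 1)
      P : List (List ℕ) → ℚ
      P ms = prodℚ (zipWith (PN N) (drop (length ks) xs) ms)
      take≡xa : take (length ks) xs ≡ xa
      take≡xa = trans (cong (λ r → take r xs) (sym eq)) (take-length-++ xa xb)
      drop≡xb : drop (length ks) xs ≡ xb
      drop≡xb = trans (cong (λ r → drop r xs) (sym eq)) (drop-length-++ xa xb)

    Zk-≡chainSum : ∀ xs ks → Zk- N xs ks ≡ chainSum 0 ks xs endConn
    Zk-≡chainSum xs ks = ∑-cong (incChains 0 (length ks) N) (λ ns → ℚP.*-assoc (Qk N ks xs ns) _ _)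

  transport : ∀ N k ks ls → 1 ≤ k → ks ≢ [] → Index ls → ls ≢ [] → ∀ xs →
    length xs ≡ length ks ℕ.+ 1 ℕ.+ length ls → Admissible N xs →
    Zkl N xs (ks ++ [ k ]) ls ≡ Zkl N xs ks (k ∷ ls)
  transport N k ks []           _ _ _        []≢[] = ⊥-elim ([]≢[] refl)
  transport N k ks (zero ∷ ls)  _ _ (() ∷ _)
  transport N (suc k) ks (suc l ∷ ls) _ ks≢[] _ _ xs len admissible
    with split-at (length ks) xs (suc (length ls)) (trans len (ℕP.+-assoc (length ks) 1 _))
  ... | xa , x′ , xb , refl , |xa|≡|ks| , _ = begin
    Zkl N (xa ++ x′ ∷ xb) (ks ++ [ suc k ]) (suc l ∷ ls)
      ≡⟨ cong (λ xs → Zkl N xs (ks ++ [ suc k ]) (suc l ∷ ls)) (sym (LP.++-assoc xa [ x′ ] xb)) ⟩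
    Zkl N ((xa ++ [ x′ ]) ++ xb) (ks ++ [ suc k ]) (suc l ∷ ls)
      ≡⟨ Zkl-split N (xa ++ [ x′ ]) xb (ks ++ [ suc k ]) (suc l ∷ ls) |xa++x′|≡|ks++k| ⟩
    chainSum N 0 (ks ++ [ suc k ]) (xa ++ [ x′ ]) (tailSum N xb (suc l ∷ ls))
      ≡⟨ chainSum-snoc N (suc k) ks xa x′ (tailSum N xb (suc l ∷ ls)) (tailSum N (x′ ∷ xb) (suc k ∷ suc l ∷ ls))
           |xa|≡|ks| ks≢[]
           (tailSum-transfer N x′ x′-admissible xb l ls k) 0 ⟩
    chainSum N 0 ks xa (tailSum N (x′ ∷ xb) (suc k ∷ suc l ∷ ls))
      ≡⟨ sym (Zkl-split N xa (x′ ∷ xb) ks (suc k ∷ suc l ∷ ls) |xa|≡|ks|) ⟩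
    Zkl N (xa ++ x′ ∷ xb) ks (suc k ∷ suc l ∷ ls)
      ∎
    where
    x′-admissible = Admissible-++-∷ xa admissible
    |xa++x′|≡|ks++k| : length (xa ++ [ x′ ]) ≡ length (ks ++ [ suc k ])
    |xa++x′|≡|ks++k| = trans (LP.length-++ xa) (trans (cong (ℕ._+ 1) |xa|≡|ks|) (sym (LP.length-++ ks)))

  transport-initial : ∀ N k ks → 1 ≤ k → ks ≢ [] → ∀ xs → length xs ≡ length ks ℕ.+ 1 → Admissible N xs →
    Zk- N xs (ks ++ [ k ]) ≡ Zkl N xs ks [ k ]
  transport-initial N (suc k) ks _ ks≢[] xs len admissible with split-at (length ks) xs 0 len
  ... | xa , x′ , [] , refl , |xa|≡|ks| , _ = begin
    Zk- N (xa ++ [ x′ ]) (ks ++ [ suc k ])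
      ≡⟨ Zk-≡chainSum N (xa ++ [ x′ ]) (ks ++ [ suc k ]) ⟩
    chainSum N 0 (ks ++ [ suc k ]) (xa ++ [ x′ ]) (endConn N)
      ≡⟨ chainSum-snoc N (suc k) ks xa x′ (endConn N) (tailSum N [ x′ ] [ suc k ]) |xa|≡|ks| ks≢[]
           (endConn-transfer N x′ (Admissible-++-∷ xa admissible) k) 0 ⟩
    chainSum N 0 ks xa (tailSum N [ x′ ] [ suc k ])
      ≡⟨ sym (Zkl-split N xa [ x′ ] ks [ suc k ] |xa|≡|ks|) ⟩
    Zkl N (xa ++ [ x′ ]) ks [ suc k ]
      ∎

  transport-final : ∀ N k ls → 1 ≤ k → Index ls → ls ≢ [] →
    ∀ xs → length xs ≡ 1 ℕ.+ length ls → Admissible N xs →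
    Zkl N xs [ k ] ls ≡ Z-k N xs (k ∷ ls)
  transport-final N k []           _ _        []≢[] = ⊥-elim ([]≢[] refl)
  transport-final N k (zero ∷ ls)  _ (() ∷ _)
  transport-final N (suc k) (suc l ∷ ls) 1≤k index _ (x ∷ xs) len (x-admissible ∷ _) = begin
    Zkl N (x ∷ xs) [ suc k ] (suc l ∷ ls)
      ≡⟨ Zkl-split N [ x ] xs [ suc k ] (suc l ∷ ls) refl ⟩
    chainSum N 0 [ suc k ] [ x ] (tailSum N xs (suc l ∷ ls))
      ≡⟨ chainSum-singleton N 0 (suc k) x (tailSum N xs (suc l ∷ ls)) ⟩
    ∑[ n ∈ 1 ⋯ N ] inv (powℚ (ι n) (suc k)) * tailSum N xs (suc l ∷ ls) x n
      ≡⟨ ∑ᵣ-cong 1 N (λ n _ _ →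
           cong (_* tailSum N xs (suc l ∷ ls) x n) (sym (ℚP.*-identityʳ (inv (powℚ (ι n) (suc k)))))) ⟩
    -- binomRatio N x x 0 computes to 1ℚ.
    ∑[ n ∈ 1 ⋯ N ] inv (powℚ (ι n) (suc k)) * binomRatio N x x 0 * tailSum N xs (suc l ∷ ls) x n
      ≡⟨ tailSum-transfer N x x-admissible xs l ls k x 0 ⟩
    tailSum N (x ∷ xs) (suc k ∷ suc l ∷ ls) x 0
      ≡⟨ tailSum-zero N (x ∷ xs) (suc k ∷ suc l ∷ ls) x ⟩
    blockSum N (x ∷ xs) (suc k ∷ suc l ∷ ls) 0
      ≡⟨ sym (Z-k≡blockSum N (x ∷ xs) (suc k ∷ suc l ∷ ls) (1≤k ∷ index) len) ⟩
    Z-k N (x ∷ xs) (suc k ∷ suc l ∷ ls)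
      ∎

open ConnectedSums using (transport; transport-initial; transport-final)

open import Data.Nat using (ℕ; _≤_; _+_)
open import Data.Rational using (ℚ)
open import Data.List using (List; []; _∷_; _++_; [_]; length)
open import Data.Product using (_×_; _,_)
open import Relation.Binary.PropositionalEquality using (_≡_; _≢_)

lemma2p3 : (N : ℕ) → 1 ≤ N → (k : ℕ) → 1 ≤ k →
    ((ks ls : List ℕ) → Index ks → Index ls → ks ≢ [] → ls ≢ [] →
       (xs : List ℚ) → length xs ≡ length ks + 1 + length ls → Admissible N xs →
       Zkl N xs (ks ++ [ k ]) ls ≡ Zkl N xs ks (k ∷ ls))
    × ((ks : List ℕ) → Index ks → ks ≢ [] →
       (xs : List ℚ) → length xs ≡ length ks + 1 → Admissible N xs →
       Zk- N xs (ks ++ [ k ]) ≡ Zkl N xs ks [ k ])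
    × ((ls : List ℕ) → Index ls → ls ≢ [] →
       (xs : List ℚ) → length xs ≡ 1 + length ls → Admissible N xs →
       Zkl N xs [ k ] ls ≡ Z-k N xs (k ∷ ls))
lemma2p3 N _ k 1≤k =
  (λ ks ls _ index ks≢[] ls≢[] → transport N k ks ls 1≤k ks≢[] index ls≢[]) ,
  (λ ks _ ks≢[] → transport-initial N k ks 1≤k ks≢[]) ,
  (λ ls index ls≢[] → transport-final N k ls 1≤k index ls≢[])
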